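{- If $\theta$ is any quantifier-free formula in the language $L$ expanded by the division symbol $/$, then there is a quantifier-free formula $\theta'$ in this expanded language in which the division symbol does not occur within the scope of $\lambda$ (i.e. within any argument of $\lambda$), such that $T\vdash\theta\leftrightarrow\theta'$.
   Context: Let $L$ be the language with constant symbols $0,1$, binary function symbols $+,-,\times$, the binary relation $<$, a unary function symbol $\lambda$, a unary predicate $A$, and unary predicates $D_n$ for each integer $n\ge 1$. Let $T$ be the $L$-theory consisting of the axioms of real closed ordered fields together with: $\forall x(A(x)\to x>0)$; $\forall x,y(A(x)\to(A(y)\leftrightarrow A(xy)))$; $A(2)\wedge\forall x(1<x<2\to\neg A(x))$; $\forall x(x>0\to\exists y(A(y)\wedge y\le x<2y))$; for each $n\ge1$, $\forall x(D_n(x)\leftrightarrow\exists y(A(y)\wedge y^n=x))$; $\forall x(x\le 0\to\lambda(x)=0)$; $\forall x(x>0\to A(\lambda(x))\wedge\lambda(x)\le x<2\lambda(x))$. Here $2$ abbreviates $1+1$. The division symbol $/$ is a binary function symbol defined in $T$ by $x/y=z\leftrightarrow((y\neq0\wedge x=yz)\vee(y=0\wedge z=0))$. -}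

module Defs where

open import Data.Nat using (ℕ; zero; suc; _+_)
open import Data.Bool using (Bool; true; false)
open import Data.Vec using (Vec; []; _∷_)
open import Data.Vec.Relation.Unary.All using (All)
open import Relation.Binary.PropositionalEquality using (_≡_)

data Fun : ℕ → Set where
  c0 c1           : Fun 0
  add sub mul     : Fun 2
  lam             : Fun 1
  div             : Fun 2

data Rel : ℕ → Set where
  lt  : Rel 2
  A   : Rel 1
  D   : ℕ → Rel 1                  -- D k denotes the predicate D_(k+1), so the D_n, n ≥ 1

isDiv : ∀ {n} → Fun n → Bool
isDiv div = true
isDiv _   = false

isLam : ∀ {n} → Fun n → Bool
isLam lam = true
isLam _   = false

-- Terms and formulas (de Bruijn variables: ∀ᶠ binds variable 0)

data Term : Set where
  var : ℕ → Term
  app : ∀ {n} → Fun n → Vec Term n → Term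

infixr 4 _⇒_
infix  6 _≐_

data Formula : Set where
  ⊥ᶠ  : Formula
  _≐_ : Term → Term → Formula
  rel : ∀ {n} → Rel n → Vec Term n → Formula
  _⇒_ : Formula → Formula → Formula
  ∀ᶠ  : Formula → Formula

¬ᶠ : Formula → Formula
¬ᶠ φ = φ ⇒ ⊥ᶠ

infixr 5 _∨ᶠ_ _∧ᶠ_
infix  3 _⇔ᶠ_

_∨ᶠ_ : Formula → Formula → Formula
φ ∨ᶠ ψ = ¬ᶠ φ ⇒ ψ

_∧ᶠ_ : Formula → Formula → Formula
φ ∧ᶠ ψ = ¬ᶠ (φ ⇒ ¬ᶠ ψ)

_⇔ᶠ_ : Formula → Formula → Formula
φ ⇔ᶠ ψ = (φ ⇒ ψ) ∧ᶠ (ψ ⇒ φ)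

∃ᶠ : Formula → Formula
∃ᶠ φ = ¬ᶠ (∀ᶠ (¬ᶠ φ))

mutual
  renameT : (ℕ → ℕ) → Term → Term
  renameT ρ (var n)    = var (ρ n)
  renameT ρ (app f ts) = app f (renameTs ρ ts)

  renameTs : ∀ {n} → (ℕ → ℕ) → Vec Term n → Vec Term n
  renameTs ρ []       = []
  renameTs ρ (t ∷ ts) = renameT ρ t ∷ renameTs ρ ts

mutual
  substT : (ℕ → Term) → Term → Term
  substT σ (var n)    = σ n
  substT σ (app f ts) = app f (substTs σ ts)

  substTs : ∀ {n} → (ℕ → Term) → Vec Term n → Vec Term n
  substTs σ []       = []
  substTs σ (t ∷ ts) = substT σ t ∷ substTs σ ts

liftσ : (ℕ → Term) → ℕ → Term
liftσ σ zero    = var zero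
liftσ σ (suc n) = renameT suc (σ n)

substF : (ℕ → Term) → Formula → Formula
substF σ ⊥ᶠ         = ⊥ᶠ
substF σ (t ≐ u)    = substT σ t ≐ substT σ u
substF σ (rel r ts) = rel r (substTs σ ts)
substF σ (φ ⇒ ψ)    = substF σ φ ⇒ substF σ ψ
substF σ (∀ᶠ φ)     = ∀ᶠ (substF (liftσ σ) φ)

shiftF : Formula → Formula
shiftF = substF (λ n → var (suc n))

sub0 : Term → ℕ → Term
sub0 t zero    = t
sub0 t (suc n) = var n

subst0 : Term → Formula → Formula
subst0 t φ = substF (sub0 t) φ

v : ℕ → Term
v = var

𝟘 𝟙 𝟚 : Term
𝟘 = app c0 []
𝟙 = app c1 []
𝟚 = app add (𝟙 ∷ 𝟙 ∷ [])

infixl 8 _+ᵗ_ _-ᵗ_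
infixl 9 _*ᵗ_ _/ᵗ_

_+ᵗ_ _-ᵗ_ _*ᵗ_ _/ᵗ_ : Term → Term → Term
a +ᵗ b = app add (a ∷ b ∷ [])
a -ᵗ b = app sub (a ∷ b ∷ [])
a *ᵗ b = app mul (a ∷ b ∷ [])
a /ᵗ b = app div (a ∷ b ∷ [])

λᵗ : Term → Term
λᵗ a = app lam (a ∷ [])

infix 6 _<ᶠ_ _≤ᶠ_

_<ᶠ_ : Term → Term → Formula
a <ᶠ b = rel lt (a ∷ b ∷ [])

_≤ᶠ_ : Term → Term → Formula
a ≤ᶠ b = (a <ᶠ b) ∨ᶠ (a ≐ b)

Aᶠ : Term → Formula
Aᶠ a = rel A (a ∷ [])

Dᶠ : ℕ → Term → Formula
Dᶠ k a = rel (D k) (a ∷ [])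

pow : Term → ℕ → Term
pow t zero    = 𝟙
pow t (suc n) = t *ᵗ pow t n

coefSum : ℕ → Term
coefSum zero    = 𝟘
coefSum (suc i) = coefSum i +ᵗ (v (suc i) *ᵗ pow (v 0) i)

monic : ℕ → Term
monic n = pow (v 0) n +ᵗ coefSum n

∀ⁿ : ℕ → Formula → Formula
∀ⁿ zero    φ = φ
∀ⁿ (suc n) φ = ∀ᶠ (∀ⁿ n φ)

-- The theory T (as a set of sentences), together with the defining
-- axiom of the division symbol /.
-- Variables: in ∀x∀y∀z. body, x = v 2, y = v 1, z = v 0.

data Ax : Formula → Set where
  add-assoc : Ax (∀ᶠ (∀ᶠ (∀ᶠ ((v 2 +ᵗ v 1) +ᵗ v 0 ≐ v 2 +ᵗ (v 1 +ᵗ v 0)))))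
  add-zero  : Ax (∀ᶠ (v 0 +ᵗ 𝟘 ≐ v 0))
  sub-def   : Ax (∀ᶠ (∀ᶠ ((v 1 -ᵗ v 0) +ᵗ v 0 ≐ v 1)))
  add-comm  : Ax (∀ᶠ (∀ᶠ (v 1 +ᵗ v 0 ≐ v 0 +ᵗ v 1)))
  mul-assoc : Ax (∀ᶠ (∀ᶠ (∀ᶠ ((v 2 *ᵗ v 1) *ᵗ v 0 ≐ v 2 *ᵗ (v 1 *ᵗ v 0)))))
  mul-one   : Ax (∀ᶠ (v 0 *ᵗ 𝟙 ≐ v 0))
  mul-comm  : Ax (∀ᶠ (∀ᶠ (v 1 *ᵗ v 0 ≐ v 0 *ᵗ v 1)))
  distrib   : Ax (∀ᶠ (∀ᶠ (∀ᶠ (v 2 *ᵗ (v 1 +ᵗ v 0) ≐ (v 2 *ᵗ v 1) +ᵗ (v 2 *ᵗ v 0)))))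
  zero≠one  : Ax (¬ᶠ (𝟘 ≐ 𝟙))
  mul-inv   : Ax (∀ᶠ (¬ᶠ (v 0 ≐ 𝟘) ⇒ ∃ᶠ (v 1 *ᵗ v 0 ≐ 𝟙)))
  lt-irrefl : Ax (∀ᶠ (¬ᶠ (v 0 <ᶠ v 0)))
  lt-trans  : Ax (∀ᶠ (∀ᶠ (∀ᶠ ((v 2 <ᶠ v 1) ∧ᶠ (v 1 <ᶠ v 0) ⇒ v 2 <ᶠ v 0))))
  lt-total  : Ax (∀ᶠ (∀ᶠ ((v 1 <ᶠ v 0) ∨ᶠ (v 1 ≐ v 0) ∨ᶠ (v 0 <ᶠ v 1))))
  lt-add    : Ax (∀ᶠ (∀ᶠ (∀ᶠ (v 2 <ᶠ v 1 ⇒ v 2 +ᵗ v 0 <ᶠ v 1 +ᵗ v 0))))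
  lt-mul    : Ax (∀ᶠ (∀ᶠ ((𝟘 <ᶠ v 1) ∧ᶠ (𝟘 <ᶠ v 0) ⇒ 𝟘 <ᶠ v 1 *ᵗ v 0)))
  pos-sqrt  : Ax (∀ᶠ (𝟘 <ᶠ v 0 ⇒ ∃ᶠ (v 0 *ᵗ v 0 ≐ v 1)))
  odd-root  : (k : ℕ) → let n = suc (k + k) in
              Ax (∀ⁿ n (∃ᶠ (monic n ≐ 𝟘)))
  A-pos     : Ax (∀ᶠ (Aᶠ (v 0) ⇒ 𝟘 <ᶠ v 0))
  A-mul     : Ax (∀ᶠ (∀ᶠ (Aᶠ (v 1) ⇒ (Aᶠ (v 0) ⇔ᶠ Aᶠ (v 1 *ᵗ v 0)))))
  A-two     : Ax (Aᶠ 𝟚 ∧ᶠ ∀ᶠ ((𝟙 <ᶠ v 0) ∧ᶠ (v 0 <ᶠ 𝟚) ⇒ ¬ᶠ (Aᶠ (v 0))))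
  A-approx  : Ax (∀ᶠ (𝟘 <ᶠ v 0 ⇒ ∃ᶠ (Aᶠ (v 0) ∧ᶠ (v 0 ≤ᶠ v 1) ∧ᶠ (v 1 <ᶠ 𝟚 *ᵗ v 0))))
  D-def     : (k : ℕ) →
              Ax (∀ᶠ (Dᶠ k (v 0) ⇔ᶠ ∃ᶠ (Aᶠ (v 0) ∧ᶠ (pow (v 0) (suc k) ≐ v 1))))
  λ-nonpos  : Ax (∀ᶠ (v 0 ≤ᶠ 𝟘 ⇒ λᵗ (v 0) ≐ 𝟘))
  λ-pos     : Ax (∀ᶠ (𝟘 <ᶠ v 0 ⇒ Aᶠ (λᵗ (v 0)) ∧ᶠ (λᵗ (v 0) ≤ᶠ v 0) ∧ᶠ (v 0 <ᶠ 𝟚 *ᵗ λᵗ (v 0))))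
  div-def   : Ax (∀ᶠ (∀ᶠ (∀ᶠ ((v 2 /ᵗ v 1 ≐ v 0) ⇔ᶠ
                 ((¬ᶠ (v 1 ≐ 𝟘) ∧ᶠ (v 2 ≐ v 1 *ᵗ v 0)) ∨ᶠ ((v 1 ≐ 𝟘) ∧ᶠ (v 0 ≐ 𝟘)))))))

infix 2 T⊢_

data T⊢_ : Formula → Set where
  ax      : ∀ {φ} → Ax φ → T⊢ φ
  ax-K    : ∀ {φ ψ} → T⊢ (φ ⇒ ψ ⇒ φ)
  ax-S    : ∀ {φ ψ χ} → T⊢ ((φ ⇒ ψ ⇒ χ) ⇒ (φ ⇒ ψ) ⇒ φ ⇒ χ)
  ax-DN   : ∀ {φ} → T⊢ (¬ᶠ (¬ᶠ φ) ⇒ φ)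
  ax-∀E   : ∀ {φ} (t : Term) → T⊢ (∀ᶠ φ ⇒ subst0 t φ)
  ax-∀D   : ∀ {φ ψ} → T⊢ (∀ᶠ (φ ⇒ ψ) ⇒ ∀ᶠ φ ⇒ ∀ᶠ ψ)
  ax-∀V   : ∀ {φ} → T⊢ (φ ⇒ ∀ᶠ (shiftF φ))
  ax-refl : (t : Term) → T⊢ (t ≐ t)
  ax-leib : ∀ {φ} (t u : Term) → T⊢ (t ≐ u ⇒ subst0 t φ ⇒ subst0 u φ)
  mp      : ∀ {φ ψ} → T⊢ (φ ⇒ ψ) → T⊢ φ → T⊢ ψ
  gen     : ∀ {φ} → T⊢ φ → T⊢ ∀ᶠ φ

data DivFree : Term → Set where
  var : ∀ {n} → DivFree (var n)
  app : ∀ {n} {f : Fun n} {ts : Vec Term n} →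
        isDiv f ≡ false → All DivFree ts → DivFree (app f ts)

data LamSafe : Term → Set where
  var    : ∀ {n} → LamSafe (var n)
  lamArg : ∀ {t} → DivFree t → LamSafe (app lam (t ∷ []))
  app    : ∀ {n} {f : Fun n} {ts : Vec Term n} →
           isLam f ≡ false → All LamSafe ts → LamSafe (app f ts)

data QF : Formula → Set where
  ⊥ᶠ  : QF ⊥ᶠ
  _≐_ : ∀ t u → QF (t ≐ u)
  rel : ∀ {n} (r : Rel n) (ts : Vec Term n) → QF (rel r ts)
  _⇒_ : ∀ {φ ψ} → QF φ → QF ψ → QF (φ ⇒ ψ)

data LamSafeF : Formula → Set where
  ⊥ᶠ  : LamSafeF ⊥ᶠ
  _≐_ : ∀ {t u} → LamSafe t → LamSafe u → LamSafeF (t ≐ u)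
  rel : ∀ {n} {r : Rel n} {ts : Vec Term n} → All LamSafe ts → LamSafeF (rel r ts)
  _⇒_ : ∀ {φ ψ} → LamSafeF φ → LamSafeF ψ → LamSafeF (φ ⇒ ψ)
  ∀ᶠ  : ∀ {φ} → LamSafeF φ → LamSafeF (∀ᶠ φ)

-- Every term t is T-provably equal, piecewise along a case distinction by
-- quantifier-free λ-safe conditions, to a fraction p / q of division-free
-- terms with q > 0. For +, −, × and / this is fraction arithmetic (a quotient
-- by p₂ / q₂ with p₂ ≠ 0 gets the positive denominator q₁ p₂²). For λ, note
-- that λ x is the unique z ∈ A with z ≤ x < 2z, because A is a multiplicative
-- group with no element in (1, 2). So for p / q > 0, λ (p / q) is λp / λq if
-- λp · q ≤ p · λq and λp / (2 λq) otherwise, and it is 0 if p / q ≤ 0.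
-- Replacing every atomic formula by the case distinction over the fractions
-- of its arguments leaves / only at the top of the arguments of atoms.

module Submission where

open import Data.Nat using (ℕ; zero; suc)
open import Data.List using (List; []; _∷_)
open import Data.List.Relation.Binary.Sublist.Propositional
  using (_⊆_; []; _∷_; _∷ʳ_; ⊆-refl; ⊆-trans)
open import Data.Vec using (Vec; []; _∷_)
open import Data.Vec.Relation.Unary.All using (All; []; _∷_)
open import Data.Product using (Σ; _×_; _,_; proj₁; proj₂)
open import Function using (_∘_)
open import Relation.Binary.PropositionalEquality
  as Eq using (_≡_; refl; trans; cong; cong₂; subst; subst₂)
open import Relation.Binary.Bundles using (Setoid)
open import Algebra.Bundles using (CommutativeSemiring)

open import Defs

mutual
  substT-renameT : ∀ σ ρ t → substT σ (renameT ρ t) ≡ substT (σ ∘ ρ) t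
  substT-renameT σ ρ (var n)    = refl
  substT-renameT σ ρ (app f ts) = cong (app f) (substTs-renameTs σ ρ ts)

  substTs-renameTs : ∀ {k} σ ρ (ts : Vec Term k) →
                     substTs σ (renameTs ρ ts) ≡ substTs (σ ∘ ρ) ts
  substTs-renameTs σ ρ []       = refl
  substTs-renameTs σ ρ (t ∷ ts) = cong₂ _∷_ (substT-renameT σ ρ t) (substTs-renameTs σ ρ ts)

mutual
  renameT-substT : ∀ ρ σ t → substT (renameT ρ ∘ σ) t ≡ renameT ρ (substT σ t)
  renameT-substT ρ σ (var n)    = refl
  renameT-substT ρ σ (app f ts) = cong (app f) (renameTs-substTs ρ σ ts)

  renameTs-substTs : ∀ {k} ρ σ (ts : Vec Term k) →
                     substTs (renameT ρ ∘ σ) ts ≡ renameTs ρ (substTs σ ts)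
  renameTs-substTs ρ σ []       = refl
  renameTs-substTs ρ σ (t ∷ ts) = cong₂ _∷_ (renameT-substT ρ σ t) (renameTs-substTs ρ σ ts)

mutual
  substT-var : ∀ t → substT var t ≡ t
  substT-var (var n)    = refl
  substT-var (app f ts) = cong (app f) (substTs-var ts)

  substTs-var : ∀ {k} (ts : Vec Term k) → substTs var ts ≡ ts
  substTs-var []       = refl
  substTs-var (t ∷ ts) = cong₂ _∷_ (substT-var t) (substTs-var ts)

mutual
  substT-cong : ∀ {σ τ} → (∀ n → σ n ≡ τ n) → ∀ t → substT σ t ≡ substT τ t
  substT-cong σ≡τ (var n)    = σ≡τ n
  substT-cong σ≡τ (app f ts) = cong (app f) (substTs-cong σ≡τ ts)

  substTs-cong : ∀ {σ τ k} → (∀ n → σ n ≡ τ n) → (ts : Vec Term k) → substTs σ ts ≡ substTs τ ts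
  substTs-cong σ≡τ []       = refl
  substTs-cong σ≡τ (t ∷ ts) = cong₂ _∷_ (substT-cong σ≡τ t) (substTs-cong σ≡τ ts)

mutual
  substT-substT : ∀ σ τ t → substT σ (substT τ t) ≡ substT (substT σ ∘ τ) t
  substT-substT σ τ (var n)    = refl
  substT-substT σ τ (app f ts) = cong (app f) (substTs-substTs σ τ ts)

  substTs-substTs : ∀ {k} σ τ (ts : Vec Term k) →
                    substTs σ (substTs τ ts) ≡ substTs (substT σ ∘ τ) ts
  substTs-substTs σ τ []       = refl
  substTs-substTs σ τ (t ∷ ts) = cong₂ _∷_ (substT-substT σ τ t) (substTs-substTs σ τ ts)

liftσ-cong : ∀ {σ τ} → (∀ n → σ n ≡ τ n) → ∀ n → liftσ σ n ≡ liftσ τ n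
liftσ-cong σ≡τ zero    = refl
liftσ-cong σ≡τ (suc n) = cong (renameT suc) (σ≡τ n)

liftσ-substT : ∀ σ τ n → substT (liftσ σ) (liftσ τ n) ≡ liftσ (substT σ ∘ τ) n
liftσ-substT σ τ zero    = refl
liftσ-substT σ τ (suc n) = trans (substT-renameT (liftσ σ) suc (τ n)) (renameT-substT suc σ (τ n))

substF-cong : ∀ {σ τ} → (∀ n → σ n ≡ τ n) → ∀ φ → substF σ φ ≡ substF τ φ
substF-cong σ≡τ ⊥ᶠ         = refl
substF-cong σ≡τ (t ≐ u)    = cong₂ _≐_ (substT-cong σ≡τ t) (substT-cong σ≡τ u)
substF-cong σ≡τ (rel r ts) = cong (rel r) (substTs-cong σ≡τ ts)
substF-cong σ≡τ (φ ⇒ ψ)    = cong₂ _⇒_ (substF-cong σ≡τ φ) (substF-cong σ≡τ ψ)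
substF-cong σ≡τ (∀ᶠ φ)     = cong ∀ᶠ (substF-cong (liftσ-cong σ≡τ) φ)

substF-substF : ∀ σ τ φ → substF σ (substF τ φ) ≡ substF (substT σ ∘ τ) φ
substF-substF σ τ ⊥ᶠ         = refl
substF-substF σ τ (t ≐ u)    = cong₂ _≐_ (substT-substT σ τ t) (substT-substT σ τ u)
substF-substF σ τ (rel r ts) = cong (rel r) (substTs-substTs σ τ ts)
substF-substF σ τ (φ ⇒ ψ)    = cong₂ _⇒_ (substF-substF σ τ φ) (substF-substF σ τ ψ)
substF-substF σ τ (∀ᶠ φ)     =
  cong ∀ᶠ (trans (substF-substF (liftσ σ) (liftσ τ) φ) (substF-cong (liftσ-substT σ τ) φ))

sub0-cancels-suc : ∀ s t → substT (sub0 s) (renameT suc t) ≡ t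
sub0-cancels-suc s t = trans (substT-renameT (sub0 s) suc t) (substT-var t)

Ctx : Set
Ctx = List Formula

_⇛_ : Ctx → Formula → Formula
[]      ⇛ φ = φ
(ψ ∷ Γ) ⇛ φ = Γ ⇛ (ψ ⇒ φ)

-- A record rather than T⊢ (Γ ⇛ φ), so that Γ and φ can be inferred.
infix 1 _⊩_
record _⊩_ (Γ : Ctx) (φ : Formula) : Set where
  constructor ⟨_⟩
  field prf : T⊢ (Γ ⇛ φ)
open _⊩_

⊢-id : ∀ {φ} → T⊢ (φ ⇒ φ)
⊢-id {φ} = mp (mp (ax-S {φ} {φ ⇒ φ} {φ}) ax-K) (ax-K {φ} {φ})

lift⊢ : ∀ {Γ φ} → T⊢ φ → Γ ⊩ φ
lift⊢ {[]}    h = ⟨ h ⟩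
lift⊢ {ψ ∷ Γ} h = ⟨ prf (lift⊢ {Γ} (mp ax-K h)) ⟩

⇒E : ∀ {Γ φ ψ} → Γ ⊩ φ ⇒ ψ → Γ ⊩ φ → Γ ⊩ ψ
⇒E {[]}    ⟨ f ⟩ ⟨ a ⟩ = ⟨ mp f a ⟩
⇒E {χ ∷ Γ} ⟨ f ⟩ ⟨ a ⟩ = ⟨ prf (⇒E {Γ} (⇒E {Γ} (lift⊢ ax-S) ⟨ f ⟩) ⟨ a ⟩) ⟩

⇒I : ∀ {Γ φ ψ} → (φ ∷ Γ) ⊩ ψ → Γ ⊩ φ ⇒ ψ
⇒I ⟨ h ⟩ = ⟨ h ⟩

⇒I⁻¹ : ∀ {Γ φ ψ} → Γ ⊩ φ ⇒ ψ → (φ ∷ Γ) ⊩ ψ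
⇒I⁻¹ ⟨ h ⟩ = ⟨ h ⟩

hyp : ∀ {Γ φ} → (φ ∷ Γ) ⊩ φ
hyp {Γ} = ⟨ prf (lift⊢ {Γ} ⊢-id) ⟩

wk : ∀ {Γ φ ψ} → Γ ⊩ φ → (ψ ∷ Γ) ⊩ φ
wk h = ⟨ prf (⇒E (lift⊢ ax-K) h) ⟩

weaken : ∀ {Γ Δ φ} → Γ ⊆ Δ → Γ ⊩ φ → Δ ⊩ φ
weaken []         h = h
weaken (refl ∷ ρ) h = ⇒I⁻¹ (weaken ρ (⇒I h))
weaken (ψ ∷ʳ ρ)   h = wk (weaken ρ h)

wk-under : ∀ {Γ φ ψ χ} → (φ ∷ Γ) ⊩ χ → (φ ∷ ψ ∷ Γ) ⊩ χ
wk-under = weaken (refl ∷ _ ∷ʳ ⊆-refl)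

¬¬E : ∀ {Γ φ} → Γ ⊩ ¬ᶠ (¬ᶠ φ) → Γ ⊩ φ
¬¬E = ⇒E (lift⊢ ax-DN)

⊥E : ∀ {Γ φ} → Γ ⊩ ⊥ᶠ → Γ ⊩ φ
⊥E h = ¬¬E (⇒I (wk h))

contradiction : ∀ {Γ φ χ} → Γ ⊩ φ → Γ ⊩ ¬ᶠ φ → Γ ⊩ χ
contradiction a b = ⊥E (⇒E b a)

cases : ∀ {Γ φ χ} → (φ ∷ Γ) ⊩ χ → (¬ᶠ φ ∷ Γ) ⊩ χ → Γ ⊩ χ
cases {Γ} {φ} {χ} yes no = ¬¬E (⇒I (⇒E hyp (⇒E (wk (⇒I no)) ¬φ)))
  where
  ¬φ : (¬ᶠ χ ∷ Γ) ⊩ ¬ᶠ φ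
  ¬φ = ⇒I (⇒E (wk hyp) (⇒E (wk (wk (⇒I yes))) hyp))

∧I : ∀ {Γ φ ψ} → Γ ⊩ φ → Γ ⊩ ψ → Γ ⊩ φ ∧ᶠ ψ
∧I a b = ⇒I (⇒E (⇒E hyp (wk a)) (wk b))

∧E₁ : ∀ {Γ φ ψ} → Γ ⊩ φ ∧ᶠ ψ → Γ ⊩ φ
∧E₁ h = ¬¬E (⇒I (⇒E (wk h) (⇒I (⇒I (contradiction (wk hyp) (wk (wk hyp)))))))

∧E₂ : ∀ {Γ φ ψ} → Γ ⊩ φ ∧ᶠ ψ → Γ ⊩ ψ
∧E₂ h = ¬¬E (⇒I (⇒E (wk h) (⇒I (wk hyp))))

∨I₁ : ∀ {Γ φ ψ} → Γ ⊩ φ → Γ ⊩ φ ∨ᶠ ψ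
∨I₁ a = ⇒I (contradiction (wk a) hyp)

∨I₂ : ∀ {Γ φ ψ} → Γ ⊩ ψ → Γ ⊩ φ ∨ᶠ ψ
∨I₂ b = ⇒I (wk b)

∨E : ∀ {Γ φ ψ χ} → Γ ⊩ φ ∨ᶠ ψ → (φ ∷ Γ) ⊩ χ → (ψ ∷ Γ) ⊩ χ → Γ ⊩ χ
∨E h a b = cases a (⇒E (wk (⇒I b)) (⇒I⁻¹ h))

⇔I : ∀ {Γ φ ψ} → (φ ∷ Γ) ⊩ ψ → (ψ ∷ Γ) ⊩ φ → Γ ⊩ φ ⇔ᶠ ψ
⇔I a b = ∧I (⇒I a) (⇒I b)

⇔E₁ : ∀ {Γ φ ψ} → Γ ⊩ φ ⇔ᶠ ψ → Γ ⊩ φ → Γ ⊩ ψ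
⇔E₁ h = ⇒E (∧E₁ h)

⇔E₂ : ∀ {Γ φ ψ} → Γ ⊩ φ ⇔ᶠ ψ → Γ ⊩ ψ → Γ ⊩ φ
⇔E₂ h = ⇒E (∧E₂ h)

⇔-refl : ∀ {Γ φ} → Γ ⊩ φ ⇔ᶠ φ
⇔-refl = ⇔I hyp hyp

⇒-cong-⇔ : ∀ {Γ φ φ′ ψ ψ′} → Γ ⊩ φ ⇔ᶠ φ′ → Γ ⊩ ψ ⇔ᶠ ψ′ → Γ ⊩ (φ ⇒ ψ) ⇔ᶠ (φ′ ⇒ ψ′)
⇒-cong-⇔ φ⇔φ′ ψ⇔ψ′ =
  ⇔I (⇒I (⇔E₁ (wk (wk ψ⇔ψ′)) (⇒E (wk hyp) (⇔E₂ (wk (wk φ⇔φ′)) hyp))))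
     (⇒I (⇔E₂ (wk (wk ψ⇔ψ′)) (⇒E (wk hyp) (⇔E₁ (wk (wk φ⇔φ′)) hyp))))

instantiate : ∀ {φ} → T⊢ ∀ᶠ φ → (t : Term) → T⊢ subst0 t φ
instantiate h t = mp (ax-∀E t) h

sub0₂ : Term → Term → ℕ → Term
sub0₂ a b zero          = b
sub0₂ a b (suc zero)    = a
sub0₂ a b (suc (suc n)) = var n

sub0₃ : Term → Term → Term → ℕ → Term
sub0₃ a b c zero                = c
sub0₃ a b c (suc zero)          = b
sub0₃ a b c (suc (suc zero))    = a
sub0₃ a b c (suc (suc (suc n))) = var n

instantiate₂ : ∀ {φ} → T⊢ ∀ᶠ (∀ᶠ φ) → (a b : Term) → T⊢ substF (sub0₂ a b) φ
instantiate₂ {φ} h a b =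
  subst T⊢_ (trans (substF-substF (sub0 b) (liftσ (sub0 a)) φ) (substF-cong agree φ))
            (instantiate (instantiate h a) b)
  where
  agree : ∀ n → substT (sub0 b) (liftσ (sub0 a) n) ≡ sub0₂ a b n
  agree zero          = refl
  agree (suc zero)    = sub0-cancels-suc b a
  agree (suc (suc n)) = refl

instantiate₃ : ∀ {φ} → T⊢ ∀ᶠ (∀ᶠ (∀ᶠ φ)) → (a b c : Term) → T⊢ substF (sub0₃ a b c) φ
instantiate₃ {φ} h a b c =
  subst T⊢_ (trans (substF-substF (sub0₂ b c) (liftσ (liftσ (sub0 a))) φ) (substF-cong agree φ))
            (instantiate₂ (instantiate h a) b c)
  where
  agree : ∀ n → substT (sub0₂ b c) (liftσ (liftσ (sub0 a)) n) ≡ sub0₃ a b c n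
  agree zero                = refl
  agree (suc zero)          = refl
  agree (suc (suc zero))    =
    trans (substT-renameT (sub0₂ b c) suc (renameT suc a))
          (trans (substT-renameT _ suc a) (substT-var a))
  agree (suc (suc (suc n))) = refl

leibniz : ∀ {Γ t u} (φ : Formula) → Γ ⊩ t ≐ u → Γ ⊩ subst0 t φ → Γ ⊩ subst0 u φ
leibniz {t = t} {u} φ t≐u = ⇒E (⇒E (lift⊢ (ax-leib {φ} t u)) t≐u)

≐-refl : ∀ {Γ} t → Γ ⊩ t ≐ t
≐-refl t = lift⊢ (ax-refl t)

≐-sym : ∀ {Γ a b} → Γ ⊩ a ≐ b → Γ ⊩ b ≐ a
≐-sym {Γ} {a} {b} a≐b = subst (λ x → Γ ⊩ b ≐ x) (sub0-cancels-suc b a)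
  (leibniz (var 0 ≐ renameT suc a) a≐b
    (subst (λ x → Γ ⊩ a ≐ x) (Eq.sym (sub0-cancels-suc a a)) (≐-refl a)))

≐-trans : ∀ {Γ a b c} → Γ ⊩ a ≐ b → Γ ⊩ b ≐ c → Γ ⊩ a ≐ c
≐-trans {Γ} {a} {b} {c} a≐b b≐c = subst (λ x → Γ ⊩ x ≐ c) (sub0-cancels-suc c a)
  (leibniz (renameT suc a ≐ var 0) b≐c
    (subst (λ x → Γ ⊩ x ≐ b) (Eq.sym (sub0-cancels-suc b a)) a≐b))

≐-setoid : Ctx → Setoid _ _
≐-setoid Γ = record
  { Carrier       = Term
  ; _≈_           = λ a b → Γ ⊩ a ≐ b
  ; isEquivalence = record { refl = ≐-refl _ ; sym = ≐-sym ; trans = ≐-trans }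
  }

module ≐-Reasoning {Γ : Ctx} where
  open import Relation.Binary.Reasoning.Setoid (≐-setoid Γ) public

-- The hole of C is the variable 0; its other variables must be shifted up by one.
≐-cong : ∀ {Γ a b} (C : Term) → Γ ⊩ a ≐ b → Γ ⊩ substT (sub0 a) C ≐ substT (sub0 b) C
≐-cong {Γ} {a} {b} C a≐b = subst (λ x → Γ ⊩ x ≐ substT (sub0 b) C) (sub0-cancels-suc b Ca)
  (leibniz (renameT suc Ca ≐ C) a≐b
    (subst (λ x → Γ ⊩ x ≐ Ca) (Eq.sym (sub0-cancels-suc a Ca)) (≐-refl Ca)))
  where Ca = substT (sub0 a) C

≐-cong₁ : ∀ {Γ a a′} (f : Fun 1) → Γ ⊩ a ≐ a′ → Γ ⊩ app f (a ∷ []) ≐ app f (a′ ∷ [])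
≐-cong₁ f = ≐-cong (app f (var 0 ∷ []))

≐-cong₂ : ∀ {Γ a a′ b b′} (f : Fun 2) → Γ ⊩ a ≐ a′ → Γ ⊩ b ≐ b′ →
          Γ ⊩ app f (a ∷ b ∷ []) ≐ app f (a′ ∷ b′ ∷ [])
≐-cong₂ {Γ} {a} {a′} {b} {b′} f a≐a′ b≐b′ = ≐-trans left right
  where
  left : Γ ⊩ app f (a ∷ b ∷ []) ≐ app f (a′ ∷ b ∷ [])
  left = subst₂ (λ x y → Γ ⊩ app f (a ∷ x ∷ []) ≐ app f (a′ ∷ y ∷ []))
           (sub0-cancels-suc a b) (sub0-cancels-suc a′ b)
           (≐-cong (app f (var 0 ∷ renameT suc b ∷ [])) a≐a′)
  right : Γ ⊩ app f (a′ ∷ b ∷ []) ≐ app f (a′ ∷ b′ ∷ [])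
  right = subst₂ (λ x y → Γ ⊩ app f (x ∷ b ∷ []) ≐ app f (y ∷ b′ ∷ []))
            (sub0-cancels-suc b a′) (sub0-cancels-suc b′ a′)
            (≐-cong (app f (renameT suc a′ ∷ var 0 ∷ [])) b≐b′)

rel-cong₁ : ∀ {Γ a a′} (r : Rel 1) → Γ ⊩ a ≐ a′ → Γ ⊩ rel r (a ∷ []) → Γ ⊩ rel r (a′ ∷ [])
rel-cong₁ r = leibniz (rel r (var 0 ∷ []))

rel-cong₂ : ∀ {Γ a a′ b b′} (r : Rel 2) → Γ ⊩ a ≐ a′ → Γ ⊩ b ≐ b′ →
            Γ ⊩ rel r (a ∷ b ∷ []) → Γ ⊩ rel r (a′ ∷ b′ ∷ [])
rel-cong₂ {Γ} {a} {a′} {b} {b′} r a≐a′ b≐b′ h =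
  subst (λ x → Γ ⊩ rel r (x ∷ b′ ∷ [])) (sub0-cancels-suc b′ a′)
    (leibniz (rel r (renameT suc a′ ∷ var 0 ∷ [])) b≐b′
      (subst (λ x → Γ ⊩ rel r (x ∷ b ∷ [])) (Eq.sym (sub0-cancels-suc b a′)) ra′b))
  where
  ra′b : Γ ⊩ rel r (a′ ∷ b ∷ [])
  ra′b = subst (λ x → Γ ⊩ rel r (a′ ∷ x ∷ [])) (sub0-cancels-suc a′ b)
           (leibniz (rel r (var 0 ∷ renameT suc b ∷ [])) a≐a′
             (subst (λ x → Γ ⊩ rel r (a ∷ x ∷ [])) (Eq.sym (sub0-cancels-suc a b)) h))

≐-cong-⇔ : ∀ {Γ a a′ b b′} → Γ ⊩ a ≐ a′ → Γ ⊩ b ≐ b′ → Γ ⊩ (a ≐ b) ⇔ᶠ (a′ ≐ b′)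
≐-cong-⇔ a≐a′ b≐b′ =
  ⇔I (≐-trans (≐-sym (wk a≐a′)) (≐-trans hyp (wk b≐b′)))
     (≐-trans (wk a≐a′) (≐-trans hyp (≐-sym (wk b≐b′))))

rel-cong₁-⇔ : ∀ {Γ a a′} (r : Rel 1) → Γ ⊩ a ≐ a′ → Γ ⊩ rel r (a ∷ []) ⇔ᶠ rel r (a′ ∷ [])
rel-cong₁-⇔ r a≐a′ = ⇔I (rel-cong₁ r (wk a≐a′) hyp) (rel-cong₁ r (≐-sym (wk a≐a′)) hyp)

rel-cong₂-⇔ : ∀ {Γ a a′ b b′} (r : Rel 2) → Γ ⊩ a ≐ a′ → Γ ⊩ b ≐ b′ →
              Γ ⊩ rel r (a ∷ b ∷ []) ⇔ᶠ rel r (a′ ∷ b′ ∷ [])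
rel-cong₂-⇔ r a≐a′ b≐b′ =
  ⇔I (rel-cong₂ r (wk a≐a′) (wk b≐b′) hyp) (rel-cong₂ r (≐-sym (wk a≐a′)) (≐-sym (wk b≐b′)) hyp)

+-assoc : ∀ {Γ} a b c → Γ ⊩ (a +ᵗ b) +ᵗ c ≐ a +ᵗ (b +ᵗ c)
+-assoc a b c = lift⊢ (instantiate₃ (ax add-assoc) a b c)

+-identityʳ : ∀ {Γ} a → Γ ⊩ a +ᵗ 𝟘 ≐ a
+-identityʳ a = lift⊢ (instantiate (ax add-zero) a)

a-b+b≐a : ∀ {Γ} a b → Γ ⊩ (a -ᵗ b) +ᵗ b ≐ a
a-b+b≐a a b = lift⊢ (instantiate₂ (ax sub-def) a b)

+-comm : ∀ {Γ} a b → Γ ⊩ a +ᵗ b ≐ b +ᵗ a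
+-comm a b = lift⊢ (instantiate₂ (ax add-comm) a b)

*-assoc : ∀ {Γ} a b c → Γ ⊩ (a *ᵗ b) *ᵗ c ≐ a *ᵗ (b *ᵗ c)
*-assoc a b c = lift⊢ (instantiate₃ (ax mul-assoc) a b c)

*-identityʳ : ∀ {Γ} a → Γ ⊩ a *ᵗ 𝟙 ≐ a
*-identityʳ a = lift⊢ (instantiate (ax mul-one) a)

*-comm : ∀ {Γ} a b → Γ ⊩ a *ᵗ b ≐ b *ᵗ a
*-comm a b = lift⊢ (instantiate₂ (ax mul-comm) a b)

*-distribˡ-+ : ∀ {Γ} a b c → Γ ⊩ a *ᵗ (b +ᵗ c) ≐ (a *ᵗ b) +ᵗ (a *ᵗ c)
*-distribˡ-+ a b c = lift⊢ (instantiate₃ (ax distrib) a b c)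

0≢1 : ∀ {Γ} → Γ ⊩ ¬ᶠ (𝟘 ≐ 𝟙)
0≢1 = lift⊢ (ax zero≠one)

<-irrefl : ∀ {Γ a χ} → Γ ⊩ a <ᶠ a → Γ ⊩ χ
<-irrefl {a = a} a<a = contradiction a<a (lift⊢ (instantiate (ax lt-irrefl) a))

<-trans : ∀ {Γ a b c} → Γ ⊩ a <ᶠ b → Γ ⊩ b <ᶠ c → Γ ⊩ a <ᶠ c
<-trans {a = a} {b} {c} a<b b<c = ⇒E (lift⊢ (instantiate₃ (ax lt-trans) a b c)) (∧I a<b b<c)

trichotomy : ∀ {Γ} a b {χ} → (a <ᶠ b ∷ Γ) ⊩ χ → (a ≐ b ∷ Γ) ⊩ χ → (b <ᶠ a ∷ Γ) ⊩ χ → Γ ⊩ χ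
trichotomy a b a<b a≐b b<a =
  ∨E (lift⊢ (instantiate₂ (ax lt-total) a b)) a<b (∨E hyp (wk-under a≐b) (wk-under b<a))

+-monoˡ-< : ∀ {Γ a b} c → Γ ⊩ a <ᶠ b → Γ ⊩ a +ᵗ c <ᶠ b +ᵗ c
+-monoˡ-< {a = a} {b} c = ⇒E (lift⊢ (instantiate₃ (ax lt-add) a b c))

*-pos : ∀ {Γ a b} → Γ ⊩ 𝟘 <ᶠ a → Γ ⊩ 𝟘 <ᶠ b → Γ ⊩ 𝟘 <ᶠ a *ᵗ b
*-pos {a = a} {b} 0<a 0<b = ⇒E (lift⊢ (instantiate₂ (ax lt-mul) a b)) (∧I 0<a 0<b)

A⇒pos : ∀ {Γ a} → Γ ⊩ Aᶠ a → Γ ⊩ 𝟘 <ᶠ a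
A⇒pos {a = a} = ⇒E (lift⊢ (instantiate (ax A-pos) a))

A-* : ∀ {Γ a b} → Γ ⊩ Aᶠ a → Γ ⊩ Aᶠ b → Γ ⊩ Aᶠ (a *ᵗ b)
A-* {a = a} {b} Aa = ⇔E₁ (⇒E (lift⊢ (instantiate₂ (ax A-mul) a b)) Aa)

A-cancelˡ : ∀ {Γ a b} → Γ ⊩ Aᶠ a → Γ ⊩ Aᶠ (a *ᵗ b) → Γ ⊩ Aᶠ b
A-cancelˡ {a = a} {b} Aa = ⇔E₂ (⇒E (lift⊢ (instantiate₂ (ax A-mul) a b)) Aa)

A-2 : ∀ {Γ} → Γ ⊩ Aᶠ 𝟚
A-2 = ∧E₁ (lift⊢ (ax A-two))

A-gap : ∀ {Γ a χ} → Γ ⊩ Aᶠ a → Γ ⊩ 𝟙 <ᶠ a → Γ ⊩ a <ᶠ 𝟚 → Γ ⊩ χ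
A-gap {a = a} Aa 1<a a<2 =
  contradiction Aa (⇒E (lift⊢ (instantiate (prf (∧E₂ {[]} (lift⊢ (ax A-two)))) a)) (∧I 1<a a<2))

≤0⇒λ≐0 : ∀ {Γ a} → Γ ⊩ a ≤ᶠ 𝟘 → Γ ⊩ λᵗ a ≐ 𝟘
≤0⇒λ≐0 {a = a} = ⇒E (lift⊢ (instantiate (ax λ-nonpos) a))

λ-spec : ∀ {Γ a} → Γ ⊩ 𝟘 <ᶠ a → Γ ⊩ Aᶠ (λᵗ a) ∧ᶠ (λᵗ a ≤ᶠ a) ∧ᶠ (a <ᶠ 𝟚 *ᵗ λᵗ a)
λ-spec {a = a} = ⇒E (lift⊢ (instantiate (ax λ-pos) a))

A-λ : ∀ {Γ a} → Γ ⊩ 𝟘 <ᶠ a → Γ ⊩ Aᶠ (λᵗ a)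
A-λ 0<a = ∧E₁ (λ-spec 0<a)

λ≤ : ∀ {Γ a} → Γ ⊩ 𝟘 <ᶠ a → Γ ⊩ λᵗ a ≤ᶠ a
λ≤ 0<a = ∧E₁ (∧E₂ (λ-spec 0<a))

<2λ : ∀ {Γ a} → Γ ⊩ 𝟘 <ᶠ a → Γ ⊩ a <ᶠ 𝟚 *ᵗ λᵗ a
<2λ 0<a = ∧E₂ (∧E₂ (λ-spec 0<a))

/-def : ∀ {Γ} a b c →
        Γ ⊩ (a /ᵗ b ≐ c) ⇔ᶠ ((¬ᶠ (b ≐ 𝟘) ∧ᶠ (a ≐ b *ᵗ c)) ∨ᶠ ((b ≐ 𝟘) ∧ᶠ (c ≐ 𝟘)))
/-def a b c = lift⊢ (instantiate₃ (ax div-def) a b c)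

-- Ordered field arithmetic

infix 4 _≈ᵗ_
_≈ᵗ_ : Term → Term → Set
a ≈ᵗ b = [] ⊩ a ≐ b

x+x≐x⇒x≐0 : ∀ {Γ} x → Γ ⊩ x +ᵗ x ≐ x → Γ ⊩ x ≐ 𝟘
x+x≐x⇒x≐0 x x+x≐x = begin
  x                     ≈⟨ +-identityʳ x ⟨
  x +ᵗ 𝟘                ≈⟨ +-comm x 𝟘 ⟩
  𝟘 +ᵗ x                ≈⟨ ≐-cong₂ add (a-b+b≐a 𝟘 x) (≐-refl x) ⟨
  (𝟘 -ᵗ x) +ᵗ x +ᵗ x    ≈⟨ +-assoc _ x x ⟩
  (𝟘 -ᵗ x) +ᵗ (x +ᵗ x)  ≈⟨ ≐-cong₂ add (≐-refl (𝟘 -ᵗ x)) x+x≐x ⟩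
  (𝟘 -ᵗ x) +ᵗ x         ≈⟨ a-b+b≐a 𝟘 x ⟩
  𝟘                     ∎
  where open ≐-Reasoning

*-zeroʳ : ∀ {Γ} x → Γ ⊩ x *ᵗ 𝟘 ≐ 𝟘
*-zeroʳ x = x+x≐x⇒x≐0 (x *ᵗ 𝟘)
  (≐-trans (≐-sym (*-distribˡ-+ x 𝟘 𝟘)) (≐-cong₂ mul (≐-refl x) (+-identityʳ 𝟘)))

open import Algebra.Structures _≈ᵗ_ using (IsCommutativeMonoid)
open import Algebra.Structures.Biased _≈ᵗ_ using (IsCommutativeMonoidʳ; IsCommutativeSemiringʳ)

termSemiring : CommutativeSemiring _ _
termSemiring = record
  { Carrier = Term ; _≈_ = _≈ᵗ_ ; _+_ = _+ᵗ_ ; _*_ = _*ᵗ_ ; 0# = 𝟘 ; 1# = 𝟙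
  ; isCommutativeSemiring = IsCommutativeSemiringʳ.isCommutativeSemiring (record
      { +-isCommutativeMonoid = commutativeMonoid add +-assoc +-identityʳ +-comm
      ; *-isCommutativeMonoid = commutativeMonoid mul *-assoc *-identityʳ *-comm
      ; distribˡ              = *-distribˡ-+
      ; zeroʳ                 = *-zeroʳ
      })
  }
  where
  commutativeMonoid : ∀ (f : Fun 2) {e} → let _∙_ = λ a b → app f (a ∷ b ∷ []) in
    (∀ a b c → (a ∙ b) ∙ c ≈ᵗ a ∙ (b ∙ c)) → (∀ a → a ∙ e ≈ᵗ a) → (∀ a b → a ∙ b ≈ᵗ b ∙ a) →
    IsCommutativeMonoid _∙_ e
  commutativeMonoid f assoc identityʳ comm = IsCommutativeMonoidʳ.isCommutativeMonoid (record
    { isSemigroup = record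
        { isMagma = record { isEquivalence = Setoid.isEquivalence (≐-setoid []) ; ∙-cong = ≐-cong₂ f }
        ; assoc   = assoc }
    ; identityʳ   = identityʳ
    ; comm        = comm })

open import Algebra.Solver.Ring.NaturalCoefficients.Default termSemiring
  using (solve; _:+_; _:*_; _:=_)

byRing : ∀ {Γ a b} → a ≈ᵗ b → Γ ⊩ a ≐ b
byRing a≈b = lift⊢ (prf a≈b)

neg : Term → Term
neg x = 𝟘 -ᵗ x

<-cong : ∀ {Γ a a′ b b′} → Γ ⊩ a ≐ a′ → Γ ⊩ b ≐ b′ → Γ ⊩ a <ᶠ b → Γ ⊩ a′ <ᶠ b′
<-cong = rel-cong₂ lt

≤-cong : ∀ {Γ a a′ b b′} → Γ ⊩ a ≐ a′ → Γ ⊩ b ≐ b′ → Γ ⊩ a ≤ᶠ b → Γ ⊩ a′ ≤ᶠ b′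
≤-cong a≐a′ b≐b′ a≤b = ∨E a≤b
  (∨I₁ (<-cong (wk a≐a′) (wk b≐b′) hyp))
  (∨I₂ (≐-trans (≐-sym (wk a≐a′)) (≐-trans hyp (wk b≐b′))))

<-asym : ∀ {Γ a b χ} → Γ ⊩ a <ᶠ b → Γ ⊩ b <ᶠ a → Γ ⊩ χ
<-asym a<b b<a = <-irrefl (<-trans a<b b<a)

<⇒≢ : ∀ {Γ a b χ} → Γ ⊩ a <ᶠ b → Γ ⊩ a ≐ b → Γ ⊩ χ
<⇒≢ a<b a≐b = <-irrefl (<-cong (≐-refl _) (≐-sym a≐b) a<b)

≤-<-trans : ∀ {Γ a b c} → Γ ⊩ a ≤ᶠ b → Γ ⊩ b <ᶠ c → Γ ⊩ a <ᶠ c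
≤-<-trans a≤b b<c = ∨E a≤b (<-trans hyp (wk b<c)) (<-cong (≐-sym hyp) (≐-refl _) (wk b<c))

<-≤-trans : ∀ {Γ a b c} → Γ ⊩ a <ᶠ b → Γ ⊩ b ≤ᶠ c → Γ ⊩ a <ᶠ c
<-≤-trans a<b b≤c = ∨E b≤c (<-trans (wk a<b) hyp) (<-cong (≐-refl _) hyp (wk a<b))

+-identityˡ : ∀ {Γ} a → Γ ⊩ 𝟘 +ᵗ a ≐ a
+-identityˡ a = ≐-trans (+-comm 𝟘 a) (+-identityʳ a)

*-identityˡ : ∀ {Γ} a → Γ ⊩ 𝟙 *ᵗ a ≐ a
*-identityˡ a = ≐-trans (*-comm 𝟙 a) (*-identityʳ a)

*-zeroˡ : ∀ {Γ} a → Γ ⊩ 𝟘 *ᵗ a ≐ 𝟘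
*-zeroˡ a = ≐-trans (*-comm 𝟘 a) (*-zeroʳ a)

neg-inverseˡ : ∀ {Γ} a → Γ ⊩ neg a +ᵗ a ≐ 𝟘
neg-inverseˡ = a-b+b≐a 𝟘

neg-inverseʳ : ∀ {Γ} a → Γ ⊩ a +ᵗ neg a ≐ 𝟘
neg-inverseʳ a = ≐-trans (+-comm a (neg a)) (neg-inverseˡ a)

+-cancelʳ : ∀ {Γ a c} b → Γ ⊩ a +ᵗ b ≐ c +ᵗ b → Γ ⊩ a ≐ c
+-cancelʳ {a = a} {c} b a+b≐c+b = begin
  a                     ≈⟨ +-identityʳ a ⟨
  a +ᵗ 𝟘                ≈⟨ ≐-cong₂ add (≐-refl a) (neg-inverseʳ b) ⟨
  a +ᵗ (b +ᵗ neg b)     ≈⟨ +-assoc a b (neg b) ⟨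
  (a +ᵗ b) +ᵗ neg b     ≈⟨ ≐-cong₂ add a+b≐c+b (≐-refl _) ⟩
  (c +ᵗ b) +ᵗ neg b     ≈⟨ +-assoc c b (neg b) ⟩
  c +ᵗ (b +ᵗ neg b)     ≈⟨ ≐-cong₂ add (≐-refl c) (neg-inverseʳ b) ⟩
  c +ᵗ 𝟘                ≈⟨ +-identityʳ c ⟩
  c                     ∎
  where open ≐-Reasoning

c+b≐a⇒a-b≐c : ∀ {Γ a b c} → Γ ⊩ c +ᵗ b ≐ a → Γ ⊩ a -ᵗ b ≐ c
c+b≐a⇒a-b≐c {a = a} {b} c+b≐a = +-cancelʳ b (≐-trans (a-b+b≐a a b) (≐-sym c+b≐a))

x<d+x : ∀ {Γ d} x → Γ ⊩ 𝟘 <ᶠ d → Γ ⊩ x <ᶠ d +ᵗ x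
x<d+x x 0<d = <-cong (+-identityˡ x) (≐-refl _) (+-monoˡ-< x 0<d)

+-pos : ∀ {Γ a b} → Γ ⊩ 𝟘 <ᶠ a → Γ ⊩ 𝟘 <ᶠ b → Γ ⊩ 𝟘 <ᶠ a +ᵗ b
+-pos 0<a 0<b = <-trans 0<b (x<d+x _ 0<a)

<⇒0<b-a : ∀ {Γ a b} → Γ ⊩ a <ᶠ b → Γ ⊩ 𝟘 <ᶠ b +ᵗ neg a
<⇒0<b-a {a = a} a<b = <-cong (neg-inverseʳ a) (≐-refl _) (+-monoˡ-< (neg a) a<b)

b-a+a≐b : ∀ {Γ} a b → Γ ⊩ (b +ᵗ neg a) +ᵗ a ≐ b
b-a+a≐b a b = ≐-trans (+-assoc b (neg a) a)
  (≐-trans (≐-cong₂ add (≐-refl b) (neg-inverseˡ a)) (+-identityʳ b))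

*-monoˡ-< : ∀ {Γ a b c} → Γ ⊩ a <ᶠ b → Γ ⊩ 𝟘 <ᶠ c → Γ ⊩ a *ᵗ c <ᶠ b *ᵗ c
*-monoˡ-< {Γ} {a} {b} {c} a<b 0<c =
  <-cong (≐-refl _) dc+ac≐bc (x<d+x (a *ᵗ c) (*-pos (<⇒0<b-a a<b) 0<c))
  where
  d = b +ᵗ neg a
  dc+ac≐bc : Γ ⊩ d *ᵗ c +ᵗ a *ᵗ c ≐ b *ᵗ c
  dc+ac≐bc = ≐-trans (byRing (solve 3 (λ d a c → d :* c :+ a :* c := (d :+ a) :* c) (≐-refl _) d a c))
                      (≐-cong₂ mul (b-a+a≐b a b) (≐-refl c))

*-monoʳ-< : ∀ {Γ a b c} → Γ ⊩ a <ᶠ b → Γ ⊩ 𝟘 <ᶠ c → Γ ⊩ c *ᵗ a <ᶠ c *ᵗ b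
*-monoʳ-< {a = a} {b} {c} a<b 0<c = <-cong (*-comm a c) (*-comm b c) (*-monoˡ-< a<b 0<c)

*-monoˡ-≤ : ∀ {Γ a b c} → Γ ⊩ a ≤ᶠ b → Γ ⊩ 𝟘 <ᶠ c → Γ ⊩ a *ᵗ c ≤ᶠ b *ᵗ c
*-monoˡ-≤ a≤b 0<c = ∨E a≤b (∨I₁ (*-monoˡ-< hyp (wk 0<c))) (∨I₂ (≐-cong₂ mul hyp (≐-refl _)))

*-cancelˡ-< : ∀ {Γ a b c} → Γ ⊩ 𝟘 <ᶠ c → Γ ⊩ c *ᵗ a <ᶠ c *ᵗ b → Γ ⊩ a <ᶠ b
*-cancelˡ-< {a = a} {b} {c} 0<c ca<cb = trichotomy a b hyp
  (<⇒≢ (wk ca<cb) (≐-cong₂ mul (≐-refl c) hyp))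
  (<-asym (wk ca<cb) (*-monoʳ-< hyp (wk 0<c)))

*-cancelˡ-≐ : ∀ {Γ a b c} → Γ ⊩ 𝟘 <ᶠ c → Γ ⊩ c *ᵗ a ≐ c *ᵗ b → Γ ⊩ a ≐ b
*-cancelˡ-≐ {a = a} {b} 0<c ca≐cb = trichotomy a b
  (<⇒≢ (*-monoʳ-< hyp (wk 0<c)) (wk ca≐cb))
  hyp
  (<⇒≢ (*-monoʳ-< hyp (wk 0<c)) (≐-sym (wk ca≐cb)))

0<⇒≢0 : ∀ {Γ b} → Γ ⊩ 𝟘 <ᶠ b → Γ ⊩ ¬ᶠ (b ≐ 𝟘)
0<⇒≢0 0<b = ⇒I (<⇒≢ (wk 0<b) (≐-sym hyp))

x≢0⇒0<x*x : ∀ {Γ x} → Γ ⊩ ¬ᶠ (x ≐ 𝟘) → Γ ⊩ 𝟘 <ᶠ x *ᵗ x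
x≢0⇒0<x*x {Γ} {x} x≢0 = trichotomy 𝟘 x
  (*-pos hyp hyp)
  (contradiction (≐-sym hyp) (wk x≢0))
  (<-cong (≐-refl _) [0-x][0-x]≐xx (*-pos (<⇒0<b-a hyp) (<⇒0<b-a hyp)))
  where
  n = neg x
  [0-x][0-x]≐xx : ∀ {Δ} → Δ ⊩ (𝟘 +ᵗ n) *ᵗ (𝟘 +ᵗ n) ≐ x *ᵗ x
  [0-x][0-x]≐xx {Δ} = begin
    (𝟘 +ᵗ n) *ᵗ (𝟘 +ᵗ n)     ≈⟨ ≐-cong₂ mul (+-identityˡ n) (+-identityˡ n) ⟩
    n *ᵗ n                   ≈⟨ +-identityʳ _ ⟨
    n *ᵗ n +ᵗ 𝟘              ≈⟨ ≐-cong₂ add (≐-refl _) (≐-trans (≐-cong₂ mul (≐-refl x) n+x≐0) (*-zeroʳ x)) ⟨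
    n *ᵗ n +ᵗ x *ᵗ (n +ᵗ x)  ≈⟨ byRing (solve 2 (λ n x → n :* n :+ x :* (n :+ x) := x :* x :+ (n :+ x) :* n)
                                                (≐-refl _) n x) ⟩
    x *ᵗ x +ᵗ (n +ᵗ x) *ᵗ n  ≈⟨ ≐-cong₂ add (≐-refl _) (≐-trans (≐-cong₂ mul n+x≐0 (≐-refl n)) (*-zeroˡ n)) ⟩
    x *ᵗ x +ᵗ 𝟘              ≈⟨ +-identityʳ _ ⟩
    x *ᵗ x                   ∎
    where
    open ≐-Reasoning
    n+x≐0 : Δ ⊩ n +ᵗ x ≐ 𝟘
    n+x≐0 = neg-inverseˡ x

a≐b*[a/b] : ∀ {Γ a b} → Γ ⊩ ¬ᶠ (b ≐ 𝟘) → Γ ⊩ a ≐ b *ᵗ (a /ᵗ b)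
a≐b*[a/b] {a = a} {b} b≢0 =
  ∨E (⇔E₁ (/-def a b (a /ᵗ b)) (≐-refl _)) (∧E₂ hyp) (contradiction (∧E₁ hyp) (wk b≢0))

b≐0⇒a/b≐0 : ∀ {Γ a b} → Γ ⊩ b ≐ 𝟘 → Γ ⊩ a /ᵗ b ≐ 𝟘
b≐0⇒a/b≐0 {a = a} {b} b≐0 = ⇔E₂ (/-def a b 𝟘) (∨I₂ (∧I b≐0 (≐-refl 𝟘)))

a≐b*c⇒a/b≐c : ∀ {Γ a b c} → Γ ⊩ ¬ᶠ (b ≐ 𝟘) → Γ ⊩ a ≐ b *ᵗ c → Γ ⊩ a /ᵗ b ≐ c
a≐b*c⇒a/b≐c {a = a} {b} {c} b≢0 a≐bc = ⇔E₂ (/-def a b c) (∨I₁ (∧I b≢0 a≐bc))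

1≢0 : ∀ {Γ} → Γ ⊩ ¬ᶠ (𝟙 ≐ 𝟘)
1≢0 = ⇒I (⇒E 0≢1 (≐-sym hyp))

0<1 : ∀ {Γ} → Γ ⊩ 𝟘 <ᶠ 𝟙
0<1 = <-cong (≐-refl 𝟘) (*-identityʳ 𝟙) (x≢0⇒0<x*x 1≢0)

0<2 : ∀ {Γ} → Γ ⊩ 𝟘 <ᶠ 𝟚
0<2 = +-pos 0<1 0<1

t≐t/1 : ∀ {Γ} t → Γ ⊩ t ≐ t /ᵗ 𝟙
t≐t/1 t = ≐-sym (a≐b*c⇒a/b≐c 1≢0 (≐-sym (*-identityˡ t)))

0<a/b⇒0<a : ∀ {Γ a b} → Γ ⊩ 𝟘 <ᶠ b → Γ ⊩ 𝟘 <ᶠ a /ᵗ b → Γ ⊩ 𝟘 <ᶠ a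
0<a/b⇒0<a 0<b 0<a/b = <-cong (≐-refl 𝟘) (≐-sym (a≐b*[a/b] (0<⇒≢0 0<b))) (*-pos 0<b 0<a/b)

a*d≐bd*[a/b] : ∀ {Γ a b} d → Γ ⊩ 𝟘 <ᶠ b → Γ ⊩ a *ᵗ d ≐ (b *ᵗ d) *ᵗ (a /ᵗ b)
a*d≐bd*[a/b] {a = a} {b} d 0<b =
  ≐-trans (≐-cong₂ mul (a≐b*[a/b] (0<⇒≢0 0<b)) (≐-refl d))
          (byRing (solve 3 (λ b d x → (b :* x) :* d := (b :* d) :* x) (≐-refl _) b d (a /ᵗ b)))

c*b≐bd*[c/d] : ∀ {Γ b c d} → Γ ⊩ 𝟘 <ᶠ d → Γ ⊩ c *ᵗ b ≐ (b *ᵗ d) *ᵗ (c /ᵗ d)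
c*b≐bd*[c/d] {b = b} {c} {d} 0<d =
  ≐-trans (a*d≐bd*[a/b] b 0<d) (≐-cong₂ mul (*-comm d b) (≐-refl _))

a*d<c*b⇒a/b<c/d : ∀ {Γ a b c d} → Γ ⊩ 𝟘 <ᶠ b → Γ ⊩ 𝟘 <ᶠ d →
                  Γ ⊩ a *ᵗ d <ᶠ c *ᵗ b → Γ ⊩ a /ᵗ b <ᶠ c /ᵗ d
a*d<c*b⇒a/b<c/d 0<b 0<d ad<cb =
  *-cancelˡ-< (*-pos 0<b 0<d) (<-cong (a*d≐bd*[a/b] _ 0<b) (c*b≐bd*[c/d] 0<d) ad<cb)

a*d≐c*b⇒a/b≐c/d : ∀ {Γ a b c d} → Γ ⊩ 𝟘 <ᶠ b → Γ ⊩ 𝟘 <ᶠ d →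
                  Γ ⊩ a *ᵗ d ≐ c *ᵗ b → Γ ⊩ a /ᵗ b ≐ c /ᵗ d
a*d≐c*b⇒a/b≐c/d 0<b 0<d ad≐cb =
  *-cancelˡ-≐ (*-pos 0<b 0<d)
    (≐-trans (≐-sym (a*d≐bd*[a/b] _ 0<b)) (≐-trans ad≐cb (c*b≐bd*[c/d] 0<d)))

a*d≤c*b⇒a/b≤c/d : ∀ {Γ a b c d} → Γ ⊩ 𝟘 <ᶠ b → Γ ⊩ 𝟘 <ᶠ d →
                  Γ ⊩ a *ᵗ d ≤ᶠ c *ᵗ b → Γ ⊩ a /ᵗ b ≤ᶠ c /ᵗ d
a*d≤c*b⇒a/b≤c/d 0<b 0<d ad≤cb = ∨E ad≤cb
  (∨I₁ (a*d<c*b⇒a/b<c/d (wk 0<b) (wk 0<d) hyp))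
  (∨I₂ (a*d≐c*b⇒a/b≐c/d (wk 0<b) (wk 0<d) hyp))

a≐b*c⇒c≐a/b : ∀ {Γ a b c} → Γ ⊩ 𝟘 <ᶠ b → Γ ⊩ a ≐ b *ᵗ c → Γ ⊩ c ≐ a /ᵗ b
a≐b*c⇒c≐a/b 0<b a≐bc = ≐-sym (a≐b*c⇒a/b≐c (0<⇒≢0 0<b) a≐bc)

frac-+ : ∀ {Γ p₁ q₁ p₂ q₂} → Γ ⊩ 𝟘 <ᶠ q₁ → Γ ⊩ 𝟘 <ᶠ q₂ →
         Γ ⊩ p₁ /ᵗ q₁ +ᵗ p₂ /ᵗ q₂ ≐ (p₁ *ᵗ q₂ +ᵗ p₂ *ᵗ q₁) /ᵗ (q₁ *ᵗ q₂)
frac-+ {p₁ = p₁} {q₁} {p₂} {q₂} 0<q₁ 0<q₂ = a≐b*c⇒c≐a/b (*-pos 0<q₁ 0<q₂)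
  (≐-trans (≐-cong₂ add (a*d≐bd*[a/b] q₂ 0<q₁) (a*d≐bd*[a/b] q₁ 0<q₂))
           (byRing (solve 4 (λ q₁ q₂ x y → (q₁ :* q₂) :* x :+ (q₂ :* q₁) :* y := (q₁ :* q₂) :* (x :+ y))
                            (≐-refl _) q₁ q₂ (p₁ /ᵗ q₁) (p₂ /ᵗ q₂))))

frac-− : ∀ {Γ p₁ q₁ p₂ q₂} → Γ ⊩ 𝟘 <ᶠ q₁ → Γ ⊩ 𝟘 <ᶠ q₂ →
         Γ ⊩ p₁ /ᵗ q₁ -ᵗ p₂ /ᵗ q₂ ≐ (p₁ *ᵗ q₂ -ᵗ p₂ *ᵗ q₁) /ᵗ (q₁ *ᵗ q₂)
frac-− {p₁ = p₁} {q₁} {p₂} {q₂} 0<q₁ 0<q₂ = a≐b*c⇒c≐a/b (*-pos 0<q₁ 0<q₂) (c+b≐a⇒a-b≐c (begin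
  (q₁ *ᵗ q₂) *ᵗ (x -ᵗ y) +ᵗ p₂ *ᵗ q₁         ≈⟨ ≐-cong₂ add (≐-refl _) (a*d≐bd*[a/b] q₁ 0<q₂) ⟩
  (q₁ *ᵗ q₂) *ᵗ (x -ᵗ y) +ᵗ (q₂ *ᵗ q₁) *ᵗ y  ≈⟨ byRing (solve 4 (λ q₁ q₂ z y →
                                                 (q₁ :* q₂) :* z :+ (q₂ :* q₁) :* y := (q₁ :* q₂) :* (z :+ y))
                                                 (≐-refl _) q₁ q₂ (x -ᵗ y) y) ⟩
  (q₁ *ᵗ q₂) *ᵗ (x -ᵗ y +ᵗ y)                ≈⟨ ≐-cong₂ mul (≐-refl _) (a-b+b≐a x y) ⟩
  (q₁ *ᵗ q₂) *ᵗ x                           ≈⟨ a*d≐bd*[a/b] q₂ 0<q₁ ⟨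
  p₁ *ᵗ q₂                                  ∎))
  where
  open ≐-Reasoning
  x = p₁ /ᵗ q₁
  y = p₂ /ᵗ q₂

frac-* : ∀ {Γ p₁ q₁ p₂ q₂} → Γ ⊩ 𝟘 <ᶠ q₁ → Γ ⊩ 𝟘 <ᶠ q₂ →
         Γ ⊩ (p₁ /ᵗ q₁) *ᵗ (p₂ /ᵗ q₂) ≐ (p₁ *ᵗ p₂) /ᵗ (q₁ *ᵗ q₂)
frac-* {p₁ = p₁} {q₁} {p₂} {q₂} 0<q₁ 0<q₂ = a≐b*c⇒c≐a/b (*-pos 0<q₁ 0<q₂)
  (≐-trans (≐-cong₂ mul (a≐b*[a/b] (0<⇒≢0 0<q₁)) (a≐b*[a/b] (0<⇒≢0 0<q₂)))
           (byRing (solve 4 (λ q₁ q₂ x y → (q₁ :* x) :* (q₂ :* y) := (q₁ :* q₂) :* (x :* y))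
                            (≐-refl _) q₁ q₂ (p₁ /ᵗ q₁) (p₂ /ᵗ q₂))))

frac-/0 : ∀ {Γ p₁ q₁ p₂ q₂} → Γ ⊩ 𝟘 <ᶠ q₂ → Γ ⊩ p₂ ≐ 𝟘 → Γ ⊩ (p₁ /ᵗ q₁) /ᵗ (p₂ /ᵗ q₂) ≐ 𝟘 /ᵗ 𝟙
frac-/0 {Γ} {p₂ = p₂} {q₂} 0<q₂ p₂≐0 = ≐-trans (b≐0⇒a/b≐0 y≐0) (t≐t/1 𝟘)
  where
  y≐0 : Γ ⊩ p₂ /ᵗ q₂ ≐ 𝟘
  y≐0 = *-cancelˡ-≐ 0<q₂
    (≐-trans (≐-sym (a≐b*[a/b] (0<⇒≢0 0<q₂))) (≐-trans p₂≐0 (≐-sym (*-zeroʳ q₂))))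

frac-/ : ∀ {Γ p₁ q₁ p₂ q₂} → Γ ⊩ 𝟘 <ᶠ q₁ → Γ ⊩ 𝟘 <ᶠ q₂ → Γ ⊩ ¬ᶠ (p₂ ≐ 𝟘) →
         Γ ⊩ (p₁ /ᵗ q₁) /ᵗ (p₂ /ᵗ q₂) ≐ ((p₁ *ᵗ q₂) *ᵗ p₂) /ᵗ (q₁ *ᵗ (p₂ *ᵗ p₂))
frac-/ {Γ} {p₁} {q₁} {p₂} {q₂} 0<q₁ 0<q₂ p₂≢0 =
  a≐b*c⇒c≐a/b (*-pos 0<q₁ (x≢0⇒0<x*x p₂≢0)) (begin
    (p₁ *ᵗ q₂) *ᵗ p₂                       ≈⟨ ≐-cong₂ mul (≐-cong₂ mul p₁≐q₁yz (≐-refl q₂)) p₂≐q₂y ⟩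
    ((q₁ *ᵗ (y *ᵗ z)) *ᵗ q₂) *ᵗ (q₂ *ᵗ y)  ≈⟨ byRing (solve 4 (λ q₁ q₂ y z →
                                             ((q₁ :* (y :* z)) :* q₂) :* (q₂ :* y)
                                               := (q₁ :* ((q₂ :* y) :* (q₂ :* y))) :* z)
                                             (≐-refl _) q₁ q₂ y z) ⟩
    (q₁ *ᵗ ((q₂ *ᵗ y) *ᵗ (q₂ *ᵗ y))) *ᵗ z  ≈⟨ ≐-cong₂ mul (≐-cong₂ mul (≐-refl q₁) p₂p₂≐[q₂y][q₂y]) (≐-refl z) ⟨
    (q₁ *ᵗ (p₂ *ᵗ p₂)) *ᵗ z                ∎)
  where
  open ≐-Reasoning
  x = p₁ /ᵗ q₁
  y = p₂ /ᵗ q₂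
  z = x /ᵗ y
  p₂≐q₂y : Γ ⊩ p₂ ≐ q₂ *ᵗ y
  p₂≐q₂y = a≐b*[a/b] (0<⇒≢0 0<q₂)
  p₂p₂≐[q₂y][q₂y] : Γ ⊩ p₂ *ᵗ p₂ ≐ (q₂ *ᵗ y) *ᵗ (q₂ *ᵗ y)
  p₂p₂≐[q₂y][q₂y] = ≐-cong₂ mul p₂≐q₂y p₂≐q₂y
  y≢0 : Γ ⊩ ¬ᶠ (y ≐ 𝟘)
  y≢0 = ⇒I (contradiction (≐-trans (wk p₂≐q₂y) (≐-trans (≐-cong₂ mul (≐-refl q₂) hyp) (*-zeroʳ q₂)))
                          (wk p₂≢0))
  p₁≐q₁yz : Γ ⊩ p₁ ≐ q₁ *ᵗ (y *ᵗ z)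
  p₁≐q₁yz = ≐-trans (a≐b*[a/b] (0<⇒≢0 0<q₁)) (≐-cong₂ mul (≐-refl q₁) (a≐b*[a/b] y≢0))

-- The function λ

A-/ : ∀ {Γ u v} → Γ ⊩ Aᶠ u → Γ ⊩ Aᶠ v → Γ ⊩ Aᶠ (v /ᵗ u)
A-/ Au Av = A-cancelˡ Au (rel-cong₁ A (a≐b*[a/b] (0<⇒≢0 (A⇒pos Au))) Av)

-- v / u would be an element of A strictly between 1 and 2.
A-sparse : ∀ {Γ u v χ} → Γ ⊩ Aᶠ u → Γ ⊩ Aᶠ v → Γ ⊩ u <ᶠ v → Γ ⊩ v <ᶠ 𝟚 *ᵗ u → Γ ⊩ χ
A-sparse {Γ} {u} {v} Au Av u<v v<2u = A-gap (A-/ Au Av)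
  (*-cancelˡ-< 0<u (<-cong (≐-sym (*-identityʳ u)) v≐u*[v/u] u<v))
  (*-cancelˡ-< 0<u (<-cong v≐u*[v/u] (*-comm 𝟚 u) v<2u))
  where
  0<u : Γ ⊩ 𝟘 <ᶠ u
  0<u = A⇒pos Au
  v≐u*[v/u] : Γ ⊩ v ≐ u *ᵗ (v /ᵗ u)
  v≐u*[v/u] = a≐b*[a/b] (0<⇒≢0 0<u)

λ-unique : ∀ {Γ x z} → Γ ⊩ Aᶠ z → Γ ⊩ z ≤ᶠ x → Γ ⊩ x <ᶠ 𝟚 *ᵗ z → Γ ⊩ λᵗ x ≐ z
λ-unique {Γ} {x} {z} Az z≤x x<2z = trichotomy (λᵗ x) z
  (A-sparse (wk (A-λ 0<x)) (wk Az) hyp (≤-<-trans (wk z≤x) (wk (<2λ 0<x))))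
  hyp
  (≐-sym (A-sparse (wk Az) (wk (A-λ 0<x)) hyp (≤-<-trans (wk (λ≤ 0<x)) (wk x<2z))))
  where
  0<x : Γ ⊩ 𝟘 <ᶠ x
  0<x = <-≤-trans (A⇒pos Az) z≤x

¬pos⇒λ≐0 : ∀ {Γ x} → Γ ⊩ ¬ᶠ (𝟘 <ᶠ x) → Γ ⊩ λᵗ x ≐ 𝟘
¬pos⇒λ≐0 {x = x} x≯0 = ≤0⇒λ≐0 (trichotomy x 𝟘 (∨I₁ hyp) (∨I₂ hyp) (contradiction hyp (wk x≯0)))

λ[p/q]≐λp/λq : ∀ {Γ p q} → Γ ⊩ 𝟘 <ᶠ q → Γ ⊩ 𝟘 <ᶠ p /ᵗ q →
               Γ ⊩ λᵗ p *ᵗ q ≤ᶠ p *ᵗ λᵗ q → Γ ⊩ λᵗ (p /ᵗ q) ≐ λᵗ p /ᵗ λᵗ q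
λ[p/q]≐λp/λq {Γ} {p} {q} 0<q 0<p/q αq≤pβ =
  λ-unique (A-/ (A-λ 0<q) (A-λ 0<p)) (a*d≤c*b⇒a/b≤c/d 0<β 0<q αq≤pβ)
           (<-cong (≐-refl _) [2α]/β≐2[α/β] (a*d<c*b⇒a/b<c/d 0<q 0<β pβ<2αq))
  where
  α = λᵗ p
  β = λᵗ q
  0<p : Γ ⊩ 𝟘 <ᶠ p
  0<p = 0<a/b⇒0<a 0<q 0<p/q
  0<β : Γ ⊩ 𝟘 <ᶠ β
  0<β = A⇒pos (A-λ 0<q)
  pβ<2αq : Γ ⊩ p *ᵗ β <ᶠ (𝟚 *ᵗ α) *ᵗ q
  pβ<2αq = <-≤-trans (*-monoˡ-< (<2λ 0<p) 0<β)
    (≤-cong (*-comm β _) (*-comm q _) (*-monoˡ-≤ (λ≤ 0<q) (*-pos 0<2 (A⇒pos (A-λ 0<p)))))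
  [2α]/β≐2[α/β] : Γ ⊩ (𝟚 *ᵗ α) /ᵗ β ≐ 𝟚 *ᵗ (α /ᵗ β)
  [2α]/β≐2[α/β] = a≐b*c⇒a/b≐c (0<⇒≢0 0<β)
    (≐-trans (≐-cong₂ mul (≐-refl 𝟚) (a≐b*[a/b] (0<⇒≢0 0<β)))
             (byRing (solve 3 (λ t b z → t :* (b :* z) := b :* (t :* z)) (≐-refl _) 𝟚 β (α /ᵗ β))))

λ[p/q]≐λp/[2λq] : ∀ {Γ p q} → Γ ⊩ 𝟘 <ᶠ q → Γ ⊩ 𝟘 <ᶠ p /ᵗ q →
                  Γ ⊩ ¬ᶠ (λᵗ p *ᵗ q ≤ᶠ p *ᵗ λᵗ q) → Γ ⊩ λᵗ (p /ᵗ q) ≐ λᵗ p /ᵗ (𝟚 *ᵗ λᵗ q)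
λ[p/q]≐λp/[2λq] {Γ} {p} {q} 0<q 0<p/q αq≰pβ =
  λ-unique (A-/ (A-* A-2 (A-λ 0<q)) (A-λ 0<p)) (a*d≤c*b⇒a/b≤c/d 0<2β 0<q αq≤2pβ)
           (<-cong (≐-refl _) α/β≐2[α/2β] (a*d<c*b⇒a/b<c/d 0<q 0<β pβ<αq))
  where
  α = λᵗ p
  β = λᵗ q
  0<p : Γ ⊩ 𝟘 <ᶠ p
  0<p = 0<a/b⇒0<a 0<q 0<p/q
  0<β : Γ ⊩ 𝟘 <ᶠ β
  0<β = A⇒pos (A-λ 0<q)
  0<2β : Γ ⊩ 𝟘 <ᶠ 𝟚 *ᵗ β
  0<2β = *-pos 0<2 0<β
  αq≤2pβ : Γ ⊩ α *ᵗ q ≤ᶠ p *ᵗ (𝟚 *ᵗ β)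
  αq≤2pβ = ∨I₁ (≤-<-trans (*-monoˡ-≤ (λ≤ 0<p) 0<q) (*-monoʳ-< (<2λ 0<q) 0<p))
  pβ<αq : Γ ⊩ p *ᵗ β <ᶠ α *ᵗ q
  pβ<αq = trichotomy (α *ᵗ q) (p *ᵗ β)
    (contradiction (∨I₁ hyp) (wk αq≰pβ)) (contradiction (∨I₂ hyp) (wk αq≰pβ)) hyp
  α/β≐2[α/2β] : Γ ⊩ α /ᵗ β ≐ 𝟚 *ᵗ (α /ᵗ (𝟚 *ᵗ β))
  α/β≐2[α/2β] = a≐b*c⇒a/b≐c (0<⇒≢0 0<β)
    (≐-trans (a≐b*[a/b] (0<⇒≢0 0<2β))
             (byRing (solve 3 (λ t b z → (t :* b) :* z := b :* (t :* z)) (≐-refl _) 𝟚 β (α /ᵗ (𝟚 *ᵗ β)))))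

-- Terms as piecewise fractions

-- leaf p q stands for p / q, and node ψ l r for "l if ψ, else r".
data FracTree : Set where
  leaf : Term → Term → FracTree
  node : Formula → FracTree → FracTree → FracTree

Represents : Ctx → Term → FracTree → Set
Represents Γ t (leaf p q)   = (Γ ⊩ 𝟘 <ᶠ q) × (Γ ⊩ t ≐ p /ᵗ q)
Represents Γ t (node ψ l r) = Represents (ψ ∷ Γ) t l × Represents (¬ᶠ ψ ∷ Γ) t r

ForEachFrac : Ctx → Term → (Ctx → Term → Term → Set) → Set
ForEachFrac Γ a P = ∀ {Δ} → Γ ⊆ Δ → ∀ {p q} → Δ ⊩ 𝟘 <ᶠ q → Δ ⊩ a ≐ p /ᵗ q → P Δ p q

Represents-≐ : ∀ {Γ s s′} T → Γ ⊩ s ≐ s′ → Represents Γ s′ T → Represents Γ s T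
Represents-≐ (leaf p q)   s≐s′ (0<q , s′≐p/q) = 0<q , ≐-trans s≐s′ s′≐p/q
Represents-≐ (node ψ l r) s≐s′ (rep-l , rep-r) =
  Represents-≐ l (wk s≐s′) rep-l , Represents-≐ r (wk s≐s′) rep-r

bind : FracTree → (Term → Term → FracTree) → FracTree
bind (leaf p q)   k = k p q
bind (node ψ l r) k = node ψ (bind l k) (bind r k)

bind₂ : FracTree → FracTree → (Term → Term → Term → Term → FracTree) → FracTree
bind₂ T₁ T₂ k = bind T₁ (λ p₁ q₁ → bind T₂ (k p₁ q₁))

Represents-bind : ∀ {Γ a s} T k → Represents Γ a T →
                  ForEachFrac Γ a (λ Δ p q → Represents Δ s (k p q)) → Represents Γ s (bind T k)
Represents-bind (leaf p q)   k (0<q , a≐p/q)   rep-k = rep-k ⊆-refl 0<q a≐p/q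
Represents-bind (node ψ l r) k (rep-l , rep-r) rep-k =
  Represents-bind l k rep-l (rep-k ∘ ⊆-trans (ψ ∷ʳ ⊆-refl)) ,
  Represents-bind r k rep-r (rep-k ∘ ⊆-trans (¬ᶠ ψ ∷ʳ ⊆-refl))

Represents-app₁ : ∀ {Γ} (f : Fun 1) {a} T k → Represents Γ a T →
  (∀ {Δ p q} → Δ ⊩ 𝟘 <ᶠ q → Represents Δ (app f (p /ᵗ q ∷ [])) (k p q)) →
  Represents Γ (app f (a ∷ [])) (bind T k)
Represents-app₁ f T k rep rep-k =
  Represents-bind T k rep (λ _ 0<q a≐p/q → Represents-≐ (k _ _) (≐-cong₁ f a≐p/q) (rep-k 0<q))

Represents-app₂ : ∀ {Γ} (f : Fun 2) {a b} T₁ T₂ k → Represents Γ a T₁ → (∀ {Δ} → Represents Δ b T₂) →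
  (∀ {Δ p₁ q₁ p₂ q₂} → Δ ⊩ 𝟘 <ᶠ q₁ → Δ ⊩ 𝟘 <ᶠ q₂ →
     Represents Δ (app f (p₁ /ᵗ q₁ ∷ p₂ /ᵗ q₂ ∷ [])) (k p₁ q₁ p₂ q₂)) →
  Represents Γ (app f (a ∷ b ∷ [])) (bind₂ T₁ T₂ k)
Represents-app₂ f T₁ T₂ k rep₁ rep₂ rep-k =
  Represents-bind T₁ _ rep₁ λ _ 0<q₁ a≐p₁/q₁ →
    Represents-bind T₂ _ rep₂ λ ρ 0<q₂ b≐p₂/q₂ →
      Represents-≐ (k _ _ _ _) (≐-cong₂ f (weaken ρ a≐p₁/q₁) b≐p₂/q₂) (rep-k (weaken ρ 0<q₁) 0<q₂)

opTree : Fun 2 → Term → Term → Term → Term → FracTree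
opTree add p₁ q₁ p₂ q₂ = leaf (p₁ *ᵗ q₂ +ᵗ p₂ *ᵗ q₁) (q₁ *ᵗ q₂)
opTree sub p₁ q₁ p₂ q₂ = leaf (p₁ *ᵗ q₂ -ᵗ p₂ *ᵗ q₁) (q₁ *ᵗ q₂)
opTree mul p₁ q₁ p₂ q₂ = leaf (p₁ *ᵗ p₂) (q₁ *ᵗ q₂)
opTree div p₁ q₁ p₂ q₂ = node (p₂ ≐ 𝟘) (leaf 𝟘 𝟙) (leaf ((p₁ *ᵗ q₂) *ᵗ p₂) (q₁ *ᵗ (p₂ *ᵗ p₂)))

opTree-represents : ∀ {Δ} f {p₁ q₁ p₂ q₂} → Δ ⊩ 𝟘 <ᶠ q₁ → Δ ⊩ 𝟘 <ᶠ q₂ →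
                    Represents Δ (app f (p₁ /ᵗ q₁ ∷ p₂ /ᵗ q₂ ∷ [])) (opTree f p₁ q₁ p₂ q₂)
opTree-represents add 0<q₁ 0<q₂ = *-pos 0<q₁ 0<q₂ , frac-+ 0<q₁ 0<q₂
opTree-represents sub 0<q₁ 0<q₂ = *-pos 0<q₁ 0<q₂ , frac-− 0<q₁ 0<q₂
opTree-represents mul 0<q₁ 0<q₂ = *-pos 0<q₁ 0<q₂ , frac-* 0<q₁ 0<q₂
opTree-represents div 0<q₁ 0<q₂ =
  (0<1 , frac-/0 (wk 0<q₂) hyp) ,
  (*-pos (wk 0<q₁) (x≢0⇒0<x*x hyp) , frac-/ (wk 0<q₁) (wk 0<q₂) hyp)

lamTree : Term → Term → FracTree
lamTree p q =
  node (𝟘 <ᶠ p /ᵗ q)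
       (node (λᵗ p *ᵗ q ≤ᶠ p *ᵗ λᵗ q) (leaf (λᵗ p) (λᵗ q)) (leaf (λᵗ p) (𝟚 *ᵗ λᵗ q)))
       (leaf 𝟘 𝟙)

lamTree-represents : ∀ {Δ p q} → Δ ⊩ 𝟘 <ᶠ q → Represents Δ (λᵗ (p /ᵗ q)) (lamTree p q)
lamTree-represents {Δ} {q = q} 0<q =
  ( (wk (wk 0<λq) , λ[p/q]≐λp/λq (wk (wk 0<q)) (wk hyp) hyp)
  , (wk (wk (*-pos 0<2 0<λq)) , λ[p/q]≐λp/[2λq] (wk (wk 0<q)) (wk hyp) hyp))
  , (0<1 , ≐-trans (¬pos⇒λ≐0 hyp) (t≐t/1 𝟘))
  where
  0<λq : Δ ⊩ 𝟘 <ᶠ λᵗ q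
  0<λq = A⇒pos (A-λ 0<q)

fracTree : Term → FracTree
fracTree (var n)                = leaf (var n) 𝟙
fracTree (app c [])             = leaf (app c []) 𝟙
fracTree (app f (a ∷ b ∷ []))   = bind₂ (fracTree a) (fracTree b) (opTree f)
fracTree (app lam (a ∷ []))     = bind (fracTree a) lamTree

fracTree-represents : ∀ {Γ} t → Represents Γ t (fracTree t)
fracTree-represents (var n)              = 0<1 , t≐t/1 (var n)
fracTree-represents (app c [])           = 0<1 , t≐t/1 (app c [])
fracTree-represents (app f (a ∷ b ∷ [])) =
  Represents-app₂ f (fracTree a) (fracTree b) (opTree f)
    (fracTree-represents a) (fracTree-represents b) (opTree-represents f)
fracTree-represents (app lam (a ∷ []))   =
  Represents-app₁ lam (fracTree a) lamTree (fracTree-represents a) lamTree-represents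

-- Eliminating division under λ

QFLamSafe : Formula → Set
QFLamSafe φ = QF φ × LamSafeF φ

mutual
  DivFree⇒LamSafe : ∀ {t} → DivFree t → LamSafe t
  DivFree⇒LamSafe var                        = var
  DivFree⇒LamSafe (app {f = lam} _ (d ∷ [])) = lamArg d
  DivFree⇒LamSafe (app {f = c0} _ ds)        = app refl (All-DivFree⇒LamSafe ds)
  DivFree⇒LamSafe (app {f = c1} _ ds)        = app refl (All-DivFree⇒LamSafe ds)
  DivFree⇒LamSafe (app {f = add} _ ds)       = app refl (All-DivFree⇒LamSafe ds)
  DivFree⇒LamSafe (app {f = sub} _ ds)       = app refl (All-DivFree⇒LamSafe ds)
  DivFree⇒LamSafe (app {f = mul} _ ds)       = app refl (All-DivFree⇒LamSafe ds)
  DivFree⇒LamSafe (app {f = div} () _)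

  All-DivFree⇒LamSafe : ∀ {n} {ts : Vec Term n} → All DivFree ts → All LamSafe ts
  All-DivFree⇒LamSafe []       = []
  All-DivFree⇒LamSafe (d ∷ ds) = DivFree⇒LamSafe d ∷ All-DivFree⇒LamSafe ds

infixl 8 _+ᵈ_ _-ᵈ_
infixl 9 _*ᵈ_

_+ᵈ_ : ∀ {a b} → DivFree a → DivFree b → DivFree (a +ᵗ b)
x +ᵈ y = app refl (x ∷ y ∷ [])

_-ᵈ_ : ∀ {a b} → DivFree a → DivFree b → DivFree (a -ᵗ b)
x -ᵈ y = app refl (x ∷ y ∷ [])

_*ᵈ_ : ∀ {a b} → DivFree a → DivFree b → DivFree (a *ᵗ b)
x *ᵈ y = app refl (x ∷ y ∷ [])

λᵈ : ∀ {a} → DivFree a → DivFree (λᵗ a)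
λᵈ x = app refl (x ∷ [])

𝟘ᵈ : DivFree 𝟘
𝟘ᵈ = app refl []

𝟙ᵈ : DivFree 𝟙
𝟙ᵈ = app refl []

/-LamSafe : ∀ {p q} → DivFree p → DivFree q → LamSafe (p /ᵗ q)
/-LamSafe dp dq = app refl (DivFree⇒LamSafe dp ∷ DivFree⇒LamSafe dq ∷ [])

⇒-QFLamSafe : ∀ {φ ψ} → QFLamSafe φ → QFLamSafe ψ → QFLamSafe (φ ⇒ ψ)
⇒-QFLamSafe (qφ , lφ) (qψ , lψ) = (qφ ⇒ qψ) , (lφ ⇒ lψ)

⊥-QFLamSafe : QFLamSafe ⊥ᶠ
⊥-QFLamSafe = ⊥ᶠ , ⊥ᶠ

¬-QFLamSafe : ∀ {φ} → QFLamSafe φ → QFLamSafe (¬ᶠ φ)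
¬-QFLamSafe s = ⇒-QFLamSafe s ⊥-QFLamSafe

∧-QFLamSafe : ∀ {φ ψ} → QFLamSafe φ → QFLamSafe ψ → QFLamSafe (φ ∧ᶠ ψ)
∧-QFLamSafe sφ sψ = ¬-QFLamSafe (⇒-QFLamSafe sφ (¬-QFLamSafe sψ))

≐-QFLamSafe : ∀ {a b} → LamSafe a → LamSafe b → QFLamSafe (a ≐ b)
≐-QFLamSafe la lb = _ ≐ _ , la ≐ lb

rel₁-QFLamSafe : ∀ (r : Rel 1) {a} → LamSafe a → QFLamSafe (rel r (a ∷ []))
rel₁-QFLamSafe r la = rel _ _ , rel (la ∷ [])

rel₂-QFLamSafe : ∀ (r : Rel 2) {a b} → LamSafe a → LamSafe b → QFLamSafe (rel r (a ∷ b ∷ []))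
rel₂-QFLamSafe r la lb = rel _ _ , rel (la ∷ lb ∷ [])

≤-QFLamSafe : ∀ {a b} → LamSafe a → LamSafe b → QFLamSafe (a ≤ᶠ b)
≤-QFLamSafe la lb = ⇒-QFLamSafe (¬-QFLamSafe (rel₂-QFLamSafe lt la lb)) (≐-QFLamSafe la lb)

data SafeTree : FracTree → Set where
  leaf : ∀ {p q} → DivFree p → DivFree q → SafeTree (leaf p q)
  node : ∀ {ψ l r} → QFLamSafe ψ → SafeTree l → SafeTree r → SafeTree (node ψ l r)

bind-safe : ∀ T k → SafeTree T → (∀ {p q} → DivFree p → DivFree q → SafeTree (k p q)) →
            SafeTree (bind T k)
bind-safe (leaf p q)   k (leaf dp dq)       safe-k = safe-k dp dq
bind-safe (node ψ l r) k (node sψ sl sr) safe-k =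
  node sψ (bind-safe l k sl safe-k) (bind-safe r k sr safe-k)

opTree-safe : ∀ f {p₁ q₁ p₂ q₂} → DivFree p₁ → DivFree q₁ → DivFree p₂ → DivFree q₂ →
              SafeTree (opTree f p₁ q₁ p₂ q₂)
opTree-safe add d₁ e₁ d₂ e₂ = leaf (d₁ *ᵈ e₂ +ᵈ d₂ *ᵈ e₁) (e₁ *ᵈ e₂)
opTree-safe sub d₁ e₁ d₂ e₂ = leaf (d₁ *ᵈ e₂ -ᵈ d₂ *ᵈ e₁) (e₁ *ᵈ e₂)
opTree-safe mul d₁ e₁ d₂ e₂ = leaf (d₁ *ᵈ d₂) (e₁ *ᵈ e₂)
opTree-safe div d₁ e₁ d₂ e₂ =
  node (≐-QFLamSafe (DivFree⇒LamSafe d₂) (DivFree⇒LamSafe 𝟘ᵈ))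
       (leaf 𝟘ᵈ 𝟙ᵈ) (leaf (d₁ *ᵈ e₂ *ᵈ d₂) (e₁ *ᵈ (d₂ *ᵈ d₂)))

lamTree-safe : ∀ {p q} → DivFree p → DivFree q → SafeTree (lamTree p q)
lamTree-safe dp dq =
  node (rel₂-QFLamSafe lt (DivFree⇒LamSafe 𝟘ᵈ) (/-LamSafe dp dq))
       (node (≤-QFLamSafe (DivFree⇒LamSafe (λᵈ dp *ᵈ dq)) (DivFree⇒LamSafe (dp *ᵈ λᵈ dq)))
             (leaf (λᵈ dp) (λᵈ dq)) (leaf (λᵈ dp) ((𝟙ᵈ +ᵈ 𝟙ᵈ) *ᵈ λᵈ dq)))
       (leaf 𝟘ᵈ 𝟙ᵈ)

fracTree-safe : ∀ t → SafeTree (fracTree t)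
fracTree-safe (var n)              = leaf var 𝟙ᵈ
fracTree-safe (app c0 [])          = leaf 𝟘ᵈ 𝟙ᵈ
fracTree-safe (app c1 [])          = leaf 𝟙ᵈ 𝟙ᵈ
fracTree-safe (app f (a ∷ b ∷ [])) =
  bind-safe (fracTree a) _ (fracTree-safe a) λ d₁ e₁ →
    bind-safe (fracTree b) _ (fracTree-safe b) λ d₂ e₂ → opTree-safe f d₁ e₁ d₂ e₂
fracTree-safe (app lam (a ∷ []))   = bind-safe (fracTree a) lamTree (fracTree-safe a) lamTree-safe

casesF : FracTree → (Term → Term → Formula) → Formula
casesF (leaf p q)   k = k p q
casesF (node ψ l r) k = (ψ ⇒ casesF l k) ∧ᶠ (¬ᶠ ψ ⇒ casesF r k)

⇔-cases : ∀ {Γ φ ψ α β} → (ψ ∷ Γ) ⊩ φ ⇔ᶠ α → (¬ᶠ ψ ∷ Γ) ⊩ φ ⇔ᶠ β →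
          Γ ⊩ φ ⇔ᶠ ((ψ ⇒ α) ∧ᶠ (¬ᶠ ψ ⇒ β))
⇔-cases φ⇔α φ⇔β =
  ⇔I (∧I (⇒I (⇔E₁ (wk-under φ⇔α) (wk hyp))) (⇒I (⇔E₁ (wk-under φ⇔β) (wk hyp))))
     (cases (⇔E₂ (wk-under φ⇔α) (⇒E (∧E₁ (wk hyp)) hyp))
            (⇔E₂ (wk-under φ⇔β) (⇒E (∧E₂ (wk hyp)) hyp)))

casesF-⇔ : ∀ {Γ a φ} T k → Represents Γ a T →
           ForEachFrac Γ a (λ Δ p q → Δ ⊩ φ ⇔ᶠ k p q) → Γ ⊩ φ ⇔ᶠ casesF T k
casesF-⇔ (leaf p q)   k (0<q , a≐p/q)   φ⇔k = φ⇔k ⊆-refl 0<q a≐p/q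
casesF-⇔ (node ψ l r) k (rep-l , rep-r) φ⇔k =
  ⇔-cases (casesF-⇔ l k rep-l (φ⇔k ∘ ⊆-trans (ψ ∷ʳ ⊆-refl)))
          (casesF-⇔ r k rep-r (φ⇔k ∘ ⊆-trans (¬ᶠ ψ ∷ʳ ⊆-refl)))

casesF-safe : ∀ T k → SafeTree T → (∀ {p q} → DivFree p → DivFree q → QFLamSafe (k p q)) →
              QFLamSafe (casesF T k)
casesF-safe (leaf p q)   k (leaf dp dq)    safe-k = safe-k dp dq
casesF-safe (node ψ l r) k (node sψ sl sr) safe-k =
  ∧-QFLamSafe (⇒-QFLamSafe sψ (casesF-safe l k sl safe-k))
              (⇒-QFLamSafe (¬-QFLamSafe sψ) (casesF-safe r k sr safe-k))

hoist₁ : (Term → Formula) → Term → Formula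
hoist₁ P a = casesF (fracTree a) (λ p q → P (p /ᵗ q))

hoist₂ : (Term → Term → Formula) → Term → Term → Formula
hoist₂ P a b = casesF (fracTree a) (λ p₁ q₁ → casesF (fracTree b) (λ p₂ q₂ → P (p₁ /ᵗ q₁) (p₂ /ᵗ q₂)))

hoistDiv : ∀ {φ} → QF φ → Formula
hoistDiv ⊥ᶠ                   = ⊥ᶠ
hoistDiv (t ≐ u)              = hoist₂ _≐_ t u
hoistDiv (rel r (a ∷ []))     = hoist₁ (λ x → rel r (x ∷ [])) a
hoistDiv (rel r (a ∷ b ∷ [])) = hoist₂ (λ x y → rel r (x ∷ y ∷ [])) a b
hoistDiv (qφ ⇒ qψ)            = hoistDiv qφ ⇒ hoistDiv qψ

hoist₁-⇔ : ∀ {Γ} (P : Term → Formula) → (∀ {Δ x y} → Δ ⊩ x ≐ y → Δ ⊩ P x ⇔ᶠ P y) →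
           ∀ a → Γ ⊩ P a ⇔ᶠ hoist₁ P a
hoist₁-⇔ P P-cong a = casesF-⇔ (fracTree a) _ (fracTree-represents a) λ _ _ → P-cong

hoist₂-⇔ : ∀ {Γ} (P : Term → Term → Formula) →
           (∀ {Δ x x′ y y′} → Δ ⊩ x ≐ x′ → Δ ⊩ y ≐ y′ → Δ ⊩ P x y ⇔ᶠ P x′ y′) →
           ∀ a b → Γ ⊩ P a b ⇔ᶠ hoist₂ P a b
hoist₂-⇔ P P-cong a b =
  casesF-⇔ (fracTree a) _ (fracTree-represents a) λ _ _ a≐p₁/q₁ →
    casesF-⇔ (fracTree b) _ (fracTree-represents b) λ ρ _ → P-cong (weaken ρ a≐p₁/q₁)

hoistDiv-⇔ : ∀ {Γ φ} (qf : QF φ) → Γ ⊩ φ ⇔ᶠ hoistDiv qf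
hoistDiv-⇔ ⊥ᶠ                   = ⇔-refl
hoistDiv-⇔ (t ≐ u)              = hoist₂-⇔ _≐_ ≐-cong-⇔ t u
hoistDiv-⇔ (rel r (a ∷ []))     = hoist₁-⇔ _ (rel-cong₁-⇔ r) a
hoistDiv-⇔ (rel r (a ∷ b ∷ [])) = hoist₂-⇔ _ (rel-cong₂-⇔ r) a b
hoistDiv-⇔ (qφ ⇒ qψ)            = ⇒-cong-⇔ (hoistDiv-⇔ qφ) (hoistDiv-⇔ qψ)

hoist₁-safe : ∀ {P : Term → Formula} → (∀ {x} → LamSafe x → QFLamSafe (P x)) →
              ∀ a → QFLamSafe (hoist₁ P a)
hoist₁-safe safe-P a = casesF-safe (fracTree a) _ (fracTree-safe a) λ dp dq → safe-P (/-LamSafe dp dq)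

hoist₂-safe : ∀ {P : Term → Term → Formula} → (∀ {x y} → LamSafe x → LamSafe y → QFLamSafe (P x y)) →
              ∀ a b → QFLamSafe (hoist₂ P a b)
hoist₂-safe safe-P a b =
  casesF-safe (fracTree a) _ (fracTree-safe a) λ d₁ e₁ →
    casesF-safe (fracTree b) _ (fracTree-safe b) λ d₂ e₂ → safe-P (/-LamSafe d₁ e₁) (/-LamSafe d₂ e₂)

hoistDiv-safe : ∀ {φ} (qf : QF φ) → QFLamSafe (hoistDiv qf)
hoistDiv-safe ⊥ᶠ                   = ⊥-QFLamSafe
hoistDiv-safe (t ≐ u)              = hoist₂-safe ≐-QFLamSafe t u
hoistDiv-safe (rel r (a ∷ []))     = hoist₁-safe (rel₁-QFLamSafe r) a
hoistDiv-safe (rel r (a ∷ b ∷ [])) = hoist₂-safe (rel₂-QFLamSafe r) a b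
hoistDiv-safe (qφ ⇒ qψ)            = ⇒-QFLamSafe (hoistDiv-safe qφ) (hoistDiv-safe qψ)

lemma3p6 : (θ : Formula) → QF θ →
           Σ Formula (λ θ′ → QF θ′ × LamSafeF θ′ × (T⊢ (θ ⇔ᶠ θ′)))
lemma3p6 θ qf = hoistDiv qf , proj₁ safe , proj₂ safe , prf (hoistDiv-⇔ {[]} qf)
  where
  safe : QFLamSafe (hoistDiv qf)
  safe = hoistDiv-safe qf
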